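{- Let $d\ge 1$, and let $u_1,\dots,u_k$ and $v_1,\dots,v_m$ be linear forms on $\mathbb{R}^d$ with coefficients in $\mathbb{N}=\{1,2,3,\dots\}$, such that $\sum_{i=1}^{k}u_i(X)=\sum_{i=1}^{m}v_i(X)$ for all $X\in\mathbb{R}^d$. Then the following two statements are equivalent. (1) For every $X=(x_1,\dots,x_d)\in\mathbb{N}^d$, $$\frac{\prod_{i=1}^{k}u_i(X)!}{\prod_{i=1}^{m}v_i(X)!}\in\mathbb{N}.$$ (2) For every $l\in\mathbb{N}$ and every $X\in\mathbb{Z}^d$ such that all the numbers $\{u_i(X)/l\}$ ($1\le i\le k$) and $\{v_j(X)/l\}$ ($1\le j\le m$) are non-zero, the point $$P=\Big(\{\tfrac{ -u_1(X)}{l}\},\dots,\{\tfrac{ -u_k(X)}{l}\},\{\tfrac{v_1(X)}{l}\},\dots,\{\tfrac{v_m(X)}{l}\}\Big)\in T^{k+m}$$ defines a Gorenstein cyclic quotient singularity whose Shokurov minimal log-discrepancy is at least $k$; that is, for every integer $t$ with $1\le t\le l-1$ such that all coordinates of the multiple $\big(\{t P_1\},\dots,\{t P_{k+m}\}\big)$ are non-zero, one has $\sum_{j=1}^{k+m}\{tP_j\}\ge k$.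
   Context: $\{x\}=x-[x]$ denotes the fractional part and $[x]$ the integer part (floor) of a real number $x$. $T^N=\{(w_1,\dots,w_N)\in\mathbb{R}^N: 0\le w_i<1\}$ is the standard torus. A point $w=(w_1,\dots,w_N)\in T^N$ with rational coordinates, all of denominator dividing $l$, defines the cyclic quotient singularity $\mathbb{C}^N/\mu_l$ where $\mu\in\mu_l$ acts by multiplying the $i$-th coordinate by $\mu^{l w_i}$. Its multiples are the points $(\{t w_1\},\dots,\{t w_N\})$ for $t=1,\dots,l-1$. The Shokurov minimal log-discrepancy of the singularity is the minimum of $\sum_i \{t w_i\}$ over those multiples all of whose coordinates are non-zero (i.e. lying strictly inside $T^N$). The singularity is Gorenstein if $\sum_i w_i$ is an integer (for $P$ above this holds automatically since $\sum u_i=\sum v_i$). -}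

module Defs where

open import Data.Nat as ℕ using (ℕ; zero; suc; NonZero; _!)
open import Data.Nat.Divisibility using (_∣_)

open import Data.Integer as ℤ using (ℤ; +_)
open import Data.Rational as ℚ using (ℚ; 0ℚ; floor)
open import Data.Fin using (Fin; zero; suc; splitAt)
open import Data.Sum using ([_,_]′)
open import Data.Product using (_×_)
open import Relation.Binary.PropositionalEquality using (_≡_; _≢_)

sumℕ : ∀ {n} → (Fin n → ℕ) → ℕ
sumℕ {zero}  f = 0
sumℕ {suc n} f = f zero ℕ.+ sumℕ (λ i → f (suc i))

prodℕ : ∀ {n} → (Fin n → ℕ) → ℕ
prodℕ {zero}  f = 1
prodℕ {suc n} f = f zero ℕ.* prodℕ (λ i → f (suc i))

sumℤ : ∀ {n} → (Fin n → ℤ) → ℤ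
sumℤ {zero}  f = + 0
sumℤ {suc n} f = f zero ℤ.+ sumℤ (λ i → f (suc i))

sumℚ : ∀ {n} → (Fin n → ℚ) → ℚ
sumℚ {zero}  f = 0ℚ
sumℚ {suc n} f = f zero ℚ.+ sumℚ (λ i → f (suc i))

LinForm : ℕ → Set
LinForm d = Fin d → ℕ

evalℤ : ∀ {d} → LinForm d → (Fin d → ℤ) → ℤ
evalℤ c X = sumℤ (λ j → (+ c j) ℤ.* X j)

evalℕ : ∀ {d} → LinForm d → (Fin d → ℕ) → ℕ
evalℕ c X = sumℕ (λ j → c j ℕ.* X j)

frac : ℚ → ℚ
frac x = x ℚ.- (floor x ℚ./ 1)

pointP : ∀ {d} k m → (Fin k → LinForm d) → (Fin m → LinForm d) →
         (l : ℕ) → .{{_ : NonZero l}} → (Fin d → ℤ) → Fin (k ℕ.+ m) → ℚ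
pointP k m u v l X j =
  [ (λ i → frac ((ℤ.- evalℤ (u i) X) ℚ./ l)) , (λ i → frac (evalℤ (v i) X ℚ./ l)) ]′ (splitAt k j)

-- Gorenstein: the sum of the coordinates of w is an integer.
IsGorenstein : ∀ {N} → (Fin N → ℚ) → Set
IsGorenstein w = frac (sumℚ w) ≡ 0ℚ

MldAtLeast : ∀ {N} → (Fin N → ℚ) → (l : ℕ) → ℕ → Set
MldAtLeast w l a =
  (t : ℕ) → 1 ℕ.≤ t → t ℕ.< l →
  (∀ j → frac ((+ t ℚ./ 1) ℚ.* w j) ≢ 0ℚ) →
  (+ a ℚ./ 1) ℚ.≤ sumℚ (λ j → frac ((+ t ℚ./ 1) ℚ.* w j))

Cond1 : ∀ d k m → (Fin k → LinForm d) → (Fin m → LinForm d) → Set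
Cond1 d k m u v =
  (X : Fin d → ℕ) → (∀ j → 1 ℕ.≤ X j) →
  prodℕ (λ i → evalℕ (v i) X !) ∣ prodℕ (λ i → evalℕ (u i) X !)

Cond2 : ∀ d k m → (Fin k → LinForm d) → (Fin m → LinForm d) → Set
Cond2 d k m u v =
  (l : ℕ) → .{{_ : NonZero l}} → (X : Fin d → ℤ) →
  (∀ i → frac (evalℤ (u i) X ℚ./ l) ≢ 0ℚ) →
  (∀ j → frac (evalℤ (v j) X ℚ./ l) ≢ 0ℚ) →
  IsGorenstein (pointP k m u v l X) × MldAtLeast (pointP k m u v l X) l k

-- Both conditions are equivalent to Landau's criterion: for every Y ∈ ℕ^d and l ≥ 1,
-- Σᵢ (uᵢ(Y) mod l) ≤ Σⱼ (vⱼ(Y) mod l). Since Σᵢ uᵢ = Σⱼ vⱼ, this says Σⱼ ⌊vⱼ(Y)/l⌋ ≤ Σᵢ ⌊uᵢ(Y)/l⌋,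
-- so Legendre's formula v_p(n!) = Σₛ ⌊n/pˢ⌋ turns it into (1); conversely, evaluating (1) at
-- X ≈ (p/l)·Y for a large prime p recovers the floor inequality from the p-adic valuation.
-- The coordinates of tP are the residues of -t·uᵢ(X) and t·vⱼ(X) divided by l, and
-- {-a/l} + {a/l} = 1 when l ∤ a, so the coordinate sum of tP is k plus the excess of the
-- v-residues of tX over its u-residues, divided by l: (2) is Landau's criterion at points whose
-- residues do not vanish, which implies the general case after Y ↦ N·Y + 1, l ↦ N·l.

module Submission where

open import Defs
open import Data.Nat using (ℕ; _≤_)
open import Data.Fin using (Fin)
open import Function.Bundles using (_⇔_; mk⇔; Equivalence)
open import Relation.Binary.PropositionalEquality using (_≡_)

open import Data.Nat as ℕ using (zero; suc; _+_; _*_; _∸_; _^_; _<_; z≤n; s≤s; NonZero; _!; _/_; _%_)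
open import Data.Nat.Properties
open import Data.Nat.DivMod
open import Data.Nat.Divisibility
open import Data.Nat.Induction using (<-wellFounded)
open import Data.Nat.Primality using (Prime; euclidsLemma; prime⇒nonZero; prime⇒nonTrivial)
open import Data.Nat.Primality.Factorisation using (factorise; PrimeFactorisation)
open import Data.Nat.ListAction using (product)
open import Data.Nat.Tactic.RingSolver using (solve-∀)
open import Data.List.Base using (List; []; _∷_)
open import Data.List.Relation.Unary.All using (All; _∷_)
open import Data.Fin as Fin using (_↑ˡ_; _↑ʳ_; splitAt)
import Data.Fin.Properties as Fin
open import Data.Product using (∃-syntax; _×_; _,_; proj₁; proj₂)
open import Data.Sum using (_⊎_; inj₁; inj₂; [_,_]′)
open import Data.Empty using (⊥-elim)
open import Data.Integer as ℤ using (ℤ; -[1+_]; +[1+_]; _%ℕ_; _/ℕ_)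
import Data.Integer.Properties as ℤ
import Data.Integer.DivMod as ℤ
import Data.Integer.Tactic.RingSolver as ℤ-Ring
import Data.Nat.GCD as ℕ
open import Data.Rational as ℚ using (ℚ; 0ℚ; floor)
import Data.Rational.Properties as ℚ
open import Data.Rational.Unnormalised as ℚᵘ using (mkℚᵘ; *≡*; *≤*)
import Data.Rational.Unnormalised.Properties as ℚᵘ
open import Induction.WellFounded using (Acc; acc)
open import Relation.Nullary using (¬_; yes; no; contradiction)
open import Relation.Binary.PropositionalEquality using (_≢_; refl; sym; trans; cong; cong₂; subst; subst₂; module ≡-Reasoning)

sumℕ-cong : ∀ {n} {f g : Fin n → ℕ} → (∀ i → f i ≡ g i) → sumℕ f ≡ sumℕ g
sumℕ-cong {zero}  f≡g = refl
sumℕ-cong {suc n} f≡g = cong₂ _+_ (f≡g Fin.zero) (sumℕ-cong (λ i → f≡g (Fin.suc i)))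

sumℕ-mono-≤ : ∀ {n} {f g : Fin n → ℕ} → (∀ i → f i ≤ g i) → sumℕ f ≤ sumℕ g
sumℕ-mono-≤ {zero}  f≤g = ≤-refl
sumℕ-mono-≤ {suc n} f≤g = +-mono-≤ (f≤g Fin.zero) (sumℕ-mono-≤ (λ i → f≤g (Fin.suc i)))

sumℕ-zero : ∀ n → sumℕ {n} (λ _ → 0) ≡ 0
sumℕ-zero zero    = refl
sumℕ-zero (suc n) = sumℕ-zero n

sumℕ-const : ∀ n c → sumℕ {n} (λ _ → c) ≡ n * c
sumℕ-const zero    c = refl
sumℕ-const (suc n) c = cong (c +_) (sumℕ-const n c)

sumℕ-+ : ∀ {n} (f g : Fin n → ℕ) → sumℕ (λ i → f i + g i) ≡ sumℕ f + sumℕ g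
sumℕ-+ {zero}  f g = refl
sumℕ-+ {suc n} f g = begin
  (f₀ + g₀) + sumℕ (λ i → f (Fin.suc i) + g (Fin.suc i))
    ≡⟨ cong ((f₀ + g₀) +_) (sumℕ-+ (λ i → f (Fin.suc i)) (λ i → g (Fin.suc i))) ⟩
  (f₀ + g₀) + (sumℕ (λ i → f (Fin.suc i)) + sumℕ (λ i → g (Fin.suc i)))
    ≡⟨ +-+-interchange f₀ g₀ _ _ ⟩
  (f₀ + sumℕ (λ i → f (Fin.suc i))) + (g₀ + sumℕ (λ i → g (Fin.suc i))) ∎
  where
  open ≡-Reasoning
  f₀ = f Fin.zero
  g₀ = g Fin.zero
  +-+-interchange : ∀ a b c d → (a + b) + (c + d) ≡ (a + c) + (b + d)
  +-+-interchange = solve-∀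

sumℕ-*ˡ : ∀ {n} c (f : Fin n → ℕ) → sumℕ (λ i → c * f i) ≡ c * sumℕ f
sumℕ-*ˡ {zero}  c f = sym (*-zeroʳ c)
sumℕ-*ˡ {suc n} c f = trans (cong (c * f Fin.zero +_) (sumℕ-*ˡ c (λ i → f (Fin.suc i))))
                            (sym (*-distribˡ-+ c (f Fin.zero) _))

sumℕ-*ʳ : ∀ {n} (f : Fin n → ℕ) c → sumℕ (λ i → f i * c) ≡ sumℕ f * c
sumℕ-*ʳ f c = trans (sumℕ-cong (λ i → *-comm (f i) c)) (trans (sumℕ-*ˡ c f) (*-comm c (sumℕ f)))

sumℕ-swap : ∀ {n m} (f : Fin n → Fin m → ℕ) →
  sumℕ (λ i → sumℕ (λ j → f i j)) ≡ sumℕ (λ j → sumℕ (λ i → f i j))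
sumℕ-swap {zero}  {m} f = sym (sumℕ-zero m)
sumℕ-swap {suc n} {m} f = trans (cong (sumℕ (f Fin.zero) +_) (sumℕ-swap (λ i → f (Fin.suc i))))
                                (sym (sumℕ-+ (f Fin.zero) (λ j → sumℕ (λ i → f (Fin.suc i) j))))

sumℕ-↑ : ∀ k {m} (f : Fin (k + m) → ℕ) → sumℕ f ≡ sumℕ (λ i → f (i ↑ˡ m)) + sumℕ (λ j → f (k ↑ʳ j))
sumℕ-↑ zero    f = refl
sumℕ-↑ (suc k) f = trans (cong (f Fin.zero +_) (sumℕ-↑ k (λ i → f (Fin.suc i))))
                         (sym (+-assoc (f Fin.zero) _ _))

lookup≤sumℕ : ∀ {n} (f : Fin n → ℕ) i → f i ≤ sumℕ f
lookup≤sumℕ f Fin.zero    = m≤m+n _ _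
lookup≤sumℕ f (Fin.suc i) = ≤-trans (lookup≤sumℕ (λ j → f (Fin.suc j)) i) (m≤n+m _ _)

sumℕ-% : ∀ {n} (f : Fin n → ℕ) l .{{_ : NonZero l}} → sumℕ f % l ≡ sumℕ (λ i → f i % l) % l
sumℕ-% {zero}  f l = refl
sumℕ-% {suc n} f l = begin
  (f₀ + sumℕ f₊) % l                      ≡⟨ %-distribˡ-+ f₀ _ l ⟩
  (f₀ % l + sumℕ f₊ % l) % l              ≡⟨ cong₂ (λ a b → (a + b) % l) (sym (m%n%n≡m%n f₀ l)) (sumℕ-% f₊ l) ⟩
  (f₀ % l % l + sumℕ (λ i → f₊ i % l) % l) % l ≡⟨ sym (%-distribˡ-+ (f₀ % l) _ l) ⟩
  (f₀ % l + sumℕ (λ i → f₊ i % l)) % l    ∎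
  where
  open ≡-Reasoning
  f₀ = f Fin.zero
  f₊ = λ i → f (Fin.suc i)

sumℕ-%-cong : ∀ {n} {f g : Fin n → ℕ} l .{{_ : NonZero l}} →
  (∀ i → f i % l ≡ g i % l) → sumℕ f % l ≡ sumℕ g % l
sumℕ-%-cong {f = f} {g} l f≡g = trans (sumℕ-% f l) (trans (cong (_% l) (sumℕ-cong f≡g)) (sym (sumℕ-% g l)))

1≤sumℕ : ∀ {n} (f : Fin n → ℕ) → 1 ≤ n → (∀ i → 1 ≤ f i) → 1 ≤ sumℕ f
1≤sumℕ {suc n} f _ 1≤f = ≤-trans (1≤f Fin.zero) (m≤m+n _ _)

1≤prodℕ : ∀ {n} (f : Fin n → ℕ) → (∀ i → 1 ≤ f i) → 1 ≤ prodℕ f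
1≤prodℕ {zero}  f 1≤f = ≤-refl
1≤prodℕ {suc n} f 1≤f = *-mono-≤ (1≤f Fin.zero) (1≤prodℕ (λ i → f (Fin.suc i)) (λ i → 1≤f (Fin.suc i)))

/-unique : ∀ a q n .{{_ : NonZero n}} → q * n ≤ a → a < suc q * n → a / n ≡ q
/-unique a q n qn≤a a<[1+q]n = begin
  a / n               ≡⟨ cong (_/ n) (sym r+qn≡a) ⟩
  (r + q * n) / n     ≡⟨ +-distrib-/-∣ʳ r (divides-refl q) ⟩
  r / n + q * n / n   ≡⟨ cong₂ _+_ (m<n⇒m/n≡0 r<n) (m*n/n≡m q n) ⟩
  q                   ∎
  where
  open ≡-Reasoning
  r = a ∸ q * n
  r+qn≡a : r + q * n ≡ a
  r+qn≡a = m∸n+n≡m qn≤a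
  r<n : r < n
  r<n = +-cancelʳ-≤ (q * n) (suc r) n (subst (λ x → suc x ≤ n + q * n) (sym r+qn≡a) a<[1+q]n)

0%n≡0 : ∀ n .{{_ : NonZero n}} → 0 % n ≡ 0
0%n≡0 n = m<n⇒m%n≡m (ℕ.>-nonZero⁻¹ n)

/-suc : ∀ n q .{{_ : NonZero q}} →
  (q ∣ suc n × suc n / q ≡ suc (n / q)) ⊎ (¬ q ∣ suc n × suc n / q ≡ n / q)
/-suc n q with m≤n⇒m<n∨m≡n (m%n<n n q)
... | inj₁ 1+r<q = inj₂ (q∤1+n , /-unique (suc n) (n / q) q (≤-trans (m/n*n≤m n q) (n≤1+n n)) 1+n<[1+n/q]q)
  where
  1+n≡1+r+[n/q]q : suc n ≡ suc (n % q) + n / q * q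
  1+n≡1+r+[n/q]q = cong suc (m≡m%n+[m/n]*n n q)
  1+n<[1+n/q]q : suc n < suc (n / q) * q
  1+n<[1+n/q]q = subst (_< suc (n / q) * q) (sym 1+n≡1+r+[n/q]q) (+-monoˡ-< (n / q * q) 1+r<q)
  q∤1+n : ¬ q ∣ suc n
  q∤1+n q∣1+n = contradiction (trans (sym (trans (cong (_% q) 1+n≡1+r+[n/q]q) ([1+n]%q≡1+r)))
                                     (n∣m⇒m%n≡0 (suc n) q q∣1+n)) (λ ())
    where
    [1+n]%q≡1+r : (suc (n % q) + n / q * q) % q ≡ suc (n % q)
    [1+n]%q≡1+r = trans ([m+kn]%n≡m%n (suc (n % q)) (n / q) q) (m<n⇒m%n≡m 1+r<q)
... | inj₂ 1+r≡q = inj₁ (divides (suc (n / q)) 1+n≡[1+n/q]q , trans (cong (_/ q) 1+n≡[1+n/q]q) (m*n/n≡m (suc (n / q)) q))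
  where
  1+n≡[1+n/q]q : suc n ≡ suc (n / q) * q
  1+n≡[1+n/q]q = trans (cong suc (m≡m%n+[m/n]*n n q)) (cong (_+ n / q * q) 1+r≡q)

sumℕ-%+/ : ∀ {n} (f : Fin n → ℕ) l .{{_ : NonZero l}} →
  sumℕ f ≡ sumℕ (λ i → f i % l) + sumℕ (λ i → f i / l) * l
sumℕ-%+/ f l = begin
  sumℕ f                                          ≡⟨ sumℕ-cong (λ i → m≡m%n+[m/n]*n (f i) l) ⟩
  sumℕ (λ i → f i % l + f i / l * l)              ≡⟨ sumℕ-+ (λ i → f i % l) (λ i → f i / l * l) ⟩
  sumℕ (λ i → f i % l) + sumℕ (λ i → f i / l * l) ≡⟨ cong (sumℕ (λ i → f i % l) +_) (sumℕ-*ʳ (λ i → f i / l) l) ⟩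
  sumℕ (λ i → f i % l) + sumℕ (λ i → f i / l) * l ∎
  where open ≡-Reasoning

remainder≤⇒quotient≥ : ∀ {ra qa rb qb} l → 1 ≤ l → ra + qa * l ≡ rb + qb * l → ra ≤ rb → qb ≤ qa
remainder≤⇒quotient≥ {ra} {qa} {rb} {qb} l 1≤l eq ra≤rb with qb ≤? qa
... | yes qb≤qa = qb≤qa
... | no qb≰qa = contradiction ra≤rb (<⇒≱ rb<ra)
  where
  rb+l≤ra : rb + l ≤ ra
  rb+l≤ra = +-cancelʳ-≤ (qa * l) (rb + l) ra (begin
    (rb + l) + qa * l ≡⟨ +-assoc rb l (qa * l) ⟩
    rb + suc qa * l   ≤⟨ +-monoʳ-≤ rb (*-monoˡ-≤ l (≰⇒> qb≰qa)) ⟩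
    rb + qb * l       ≡⟨ sym eq ⟩
    ra + qa * l       ∎)
    where open ≤-Reasoning
  rb<ra : rb < ra
  rb<ra = <-≤-trans (subst (rb <_) (+-comm l rb) (m<n+m rb 1≤l)) rb+l≤ra

quotient≥⇒remainder≤ : ∀ {ra qa rb qb} l → ra + qa * l ≡ rb + qb * l → qb ≤ qa → ra ≤ rb
quotient≥⇒remainder≤ {ra} {qa} {rb} {qb} l eq qb≤qa = +-cancelʳ-≤ (qa * l) ra rb (begin
  ra + qa * l ≡⟨ eq ⟩
  rb + qb * l ≤⟨ +-monoʳ-≤ rb (*-monoˡ-≤ l qb≤qa) ⟩
  rb + qa * l ∎)
  where open ≤-Reasoning

module BalancedSums {k m} (a : Fin k → ℕ) (b : Fin m → ℕ) (Σa≡Σb : sumℕ a ≡ sumℕ b)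
                    (l : ℕ) .{{_ : NonZero l}} where

  private
    decompositions : sumℕ (λ i → a i % l) + sumℕ (λ i → a i / l) * l
                   ≡ sumℕ (λ j → b j % l) + sumℕ (λ j → b j / l) * l
    decompositions = trans (sym (sumℕ-%+/ a l)) (trans Σa≡Σb (sumℕ-%+/ b l))

  remainders≤⇒quotients≥ : sumℕ (λ i → a i % l) ≤ sumℕ (λ j → b j % l) →
                           sumℕ (λ j → b j / l) ≤ sumℕ (λ i → a i / l)
  remainders≤⇒quotients≥ = remainder≤⇒quotient≥ l (ℕ.>-nonZero⁻¹ l) decompositions

  quotients≥⇒remainders≤ : sumℕ (λ j → b j / l) ≤ sumℕ (λ i → a i / l) →
                           sumℕ (λ i → a i % l) ≤ sumℕ (λ j → b j % l)
  quotients≥⇒remainders≤ = quotient≥⇒remainder≤ l decompositions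

/-transfer : ∀ {A Z e} p l .{{_ : NonZero p}} .{{_ : NonZero l}} →
  p * Z ≤ A * l → A * l ≤ p * Z + e → e < p → A / p ≡ Z / l
/-transfer {A} {Z} {e} p l pZ≤Al Al≤pZ+e e<p = /-unique A q p qp≤A A<[1+q]p
  where
  q = Z / l
  s = Z % l
  qp≤A : q * p ≤ A
  qp≤A = *-cancelʳ-≤ (q * p) A l (begin
    q * p * l   ≡⟨ *-comm-middle q p l ⟩
    p * (q * l) ≤⟨ *-monoʳ-≤ p (m/n*n≤m Z l) ⟩
    p * Z       ≤⟨ pZ≤Al ⟩
    A * l       ∎)
    where
    open ≤-Reasoning
    *-comm-middle : ∀ x y z → x * y * z ≡ y * (x * z)
    *-comm-middle = solve-∀
  ps+e<pl : p * s + e < p * l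
  ps+e<pl = begin-strict
    p * s + e <⟨ +-monoʳ-< (p * s) e<p ⟩
    p * s + p ≡⟨ sym (*-suc-comm p s) ⟩
    p * suc s ≤⟨ *-monoʳ-≤ p (m%n<n Z l) ⟩
    p * l     ∎
    where
    open ≤-Reasoning
    *-suc-comm : ∀ x y → x * (1 + y) ≡ x * y + x
    *-suc-comm = solve-∀
  A<[1+q]p : A < suc q * p
  A<[1+q]p = *-cancelʳ-< l A (suc q * p) (begin-strict
    A * l                      ≤⟨ Al≤pZ+e ⟩
    p * Z + e                  ≡⟨ cong (λ z → p * z + e) (m≡m%n+[m/n]*n Z l) ⟩
    p * (s + q * l) + e        ≡⟨ regroup p s q l e ⟩
    (p * s + e) + q * p * l    <⟨ +-monoˡ-< (q * p * l) ps+e<pl ⟩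
    p * l + q * p * l          ≡⟨ collect p l q ⟩
    suc q * p * l              ∎)
    where
    open ≤-Reasoning
    regroup : ∀ p s q l e → p * (s + q * l) + e ≡ (p * s + e) + q * p * l
    regroup = solve-∀
    collect : ∀ p l q → p * l + q * p * l ≡ (1 + q) * p * l
    collect = solve-∀

m/n<o⇒m<o*n : ∀ {m n o} .{{_ : NonZero n}} → m / n < o → m < o * n
m/n<o⇒m<o*n {m} {n} {o} m/n<o = begin-strict
  m                 ≡⟨ m≡m%n+[m/n]*n m n ⟩
  m % n + m / n * n <⟨ +-monoˡ-< (m / n * n) (m%n<n m n) ⟩
  n + m / n * n     ≤⟨ *-monoˡ-≤ n m/n<o ⟩
  o * n             ∎
  where open ≤-Reasoning

m*[n%o]%o≡m*n%o : ∀ t x l .{{_ : NonZero l}} → t * (x % l) % l ≡ t * x % l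
m*[n%o]%o≡m*n%o t x l = begin
  t * (x % l) % l           ≡⟨ %-distribˡ-* t (x % l) l ⟩
  t % l * (x % l % l) % l   ≡⟨ cong (λ y → t % l * y % l) (m%n%n≡m%n x l) ⟩
  t % l * (x % l) % l       ≡⟨ sym (%-distribˡ-* t x l) ⟩
  t * x % l                 ∎
  where open ≡-Reasoning

[l∸x%l]%l+x≡0 : ∀ x l .{{_ : NonZero l}} → ((l ∸ x % l) % l + x) % l ≡ 0
[l∸x%l]%l+x≡0 x l = begin
  ((l ∸ r) % l + x) % l          ≡⟨ %-distribˡ-+ ((l ∸ r) % l) x l ⟩
  ((l ∸ r) % l % l + r) % l      ≡⟨ cong₂ (λ y z → (y + z) % l) (m%n%n≡m%n (l ∸ r) l) (sym (m%n%n≡m%n x l)) ⟩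
  ((l ∸ r) % l + r % l) % l      ≡⟨ sym (%-distribˡ-+ (l ∸ r) r l) ⟩
  ((l ∸ r) + r) % l              ≡⟨ cong (_% l) (m∸n+n≡m (m%n≤n x l)) ⟩
  l % l                          ≡⟨ n%n≡0 l ⟩
  0                              ∎
  where
  open ≡-Reasoning
  r = x % l

[l∸x%l]%l≢0 : ∀ x l .{{_ : NonZero l}} → x % l ≢ 0 → (l ∸ x % l) % l ≢ 0
[l∸x%l]%l≢0 x l x%l≢0 = subst (_≢ 0) (sym (m<n⇒m%n≡m l∸r<l)) (m>n⇒m∸n≢0 (m%n<n x l))
  where
  l∸r<l : l ∸ x % l < l
  l∸r<l = ∸-monoʳ-< (n≢0⇒n>0 x%l≢0) (m%n≤n x l)

complementary-residues : ∀ a b l .{{_ : NonZero l}} → (a + b) % l ≡ 0 → a % l ≢ 0 → a % l + b % l ≡ l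
complementary-residues a b l [a+b]%l≡0 a%l≢0 = from-quotient (s / l) s≡[s/l]l
  where
  s = a % l + b % l
  s≡[s/l]l : s ≡ s / l * l
  s≡[s/l]l = trans (m≡m%n+[m/n]*n s l)
                   (cong (_+ s / l * l) (trans (sym (%-distribˡ-+ a b l)) [a+b]%l≡0))
  s<2l : s < 2 * l
  s<2l = subst (s <_) (cong (l +_) (sym (+-identityʳ l))) (+-mono-< (m%n<n a l) (m%n<n b l))
  from-quotient : ∀ q → s ≡ q * l → s ≡ l
  from-quotient zero          s≡0  = contradiction (m+n≡0⇒m≡0 (a % l) s≡0) a%l≢0
  from-quotient (suc zero)    s≡l  = trans s≡l (+-identityʳ l)
  from-quotient (suc (suc q)) s≡[2+q]l = contradiction (subst (_< 2 * l) s≡[2+q]l s<2l)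
                                                       (≤⇒≯ (*-monoˡ-≤ l {2} {2 + q} (s≤s (s≤s z≤n))))

-- p-adic valuations of factorials

module Valuation (p : ℕ) (p-prime : Prime p) where

  instance
    p≢0 : NonZero p
    p≢0 = prime⇒nonZero p-prime

  1<p : 1 < p
  1<p = ℕ.nonTrivial⇒n>1 p {{prime⇒nonTrivial p-prime}}

  p∤1 : ¬ p ∣ 1
  p∤1 p∣1 = <-irrefl (sym (∣1⇒≡1 p∣1)) 1<p

  p∤* : ∀ {a b} → ¬ p ∣ a → ¬ p ∣ b → ¬ p ∣ a * b
  p∤* {a} {b} p∤a p∤b p∣ab with euclidsLemma a b p-prime p∣ab
  ... | inj₁ p∣a = p∤a p∣a
  ... | inj₂ p∣b = p∤b p∣b

  p∤⇒1≤ : ∀ {r} → ¬ p ∣ r → 1 ≤ r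
  p∤⇒1≤ {zero}  p∤0 = contradiction (p ∣0) p∤0
  p∤⇒1≤ {suc r} _   = s≤s z≤n

  p^-monoʳ-∣ : ∀ {s e} → s ≤ e → p ^ s ∣ p ^ e
  p^-monoʳ-∣ {s} {e} s≤e = divides (p ^ (e ∸ s))
    (trans (cong (p ^_) (sym (m∸n+n≡m s≤e))) (^-distribˡ-+-* p (e ∸ s) s))

  infix 4 p^_∥_
  record p^_∥_ (e n : ℕ) : Set where
    constructor exactly
    field
      cofactor   : ℕ
      factorises : n ≡ p ^ e * cofactor
      p∤cofactor : ¬ p ∣ cofactor

  ∥⇒∣ : ∀ {e n} → p^ e ∥ n → p ^ e ∣ n
  ∥⇒∣ {e} (exactly r refl _) = divides r (*-comm (p ^ e) r)

  ∥∧∣⇒≤ : ∀ {e n s} → p^ e ∥ n → p ^ s ∣ n → s ≤ e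
  ∥∧∣⇒≤ {e} {n} {s} (exactly r refl p∤r) pˢ∣n with s ≤? e
  ... | yes s≤e = s≤e
  ... | no s≰e  = contradiction (*-cancelˡ-∣ (p ^ e) {{m^n≢0 p e}} pᵉp∣pᵉr) p∤r
    where
    pᵉp∣pᵉr : p ^ e * p ∣ p ^ e * r
    pᵉp∣pᵉr = subst (_∣ p ^ e * r) (*-comm p (p ^ e)) (∣-trans (p^-monoʳ-∣ (≰⇒> s≰e)) pˢ∣n)

  ∥-* : ∀ {a b m n} → p^ a ∥ m → p^ b ∥ n → p^ (a + b) ∥ m * n
  ∥-* {a} {b} (exactly r refl p∤r) (exactly s refl p∤s) = exactly (r * s) pᵃr·pᵇs≡pᵃ⁺ᵇrs (p∤* p∤r p∤s)
    where
    pᵃr·pᵇs≡pᵃ⁺ᵇrs : p ^ a * r * (p ^ b * s) ≡ p ^ (a + b) * (r * s)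
    pᵃr·pᵇs≡pᵃ⁺ᵇrs = trans (interchange (p ^ a) r (p ^ b) s) (cong (_* (r * s)) (sym (^-distribˡ-+-* p a b)))
      where
      interchange : ∀ w x y z → w * x * (y * z) ≡ w * y * (x * z)
      interchange = solve-∀

  ∥-prodℕ : ∀ {n} (e f : Fin n → ℕ) → (∀ i → p^ e i ∥ f i) → p^ sumℕ e ∥ prodℕ f
  ∥-prodℕ {zero}  e f _  = exactly 1 refl p∤1
  ∥-prodℕ {suc n} e f ∥f = ∥-* {e Fin.zero} (∥f Fin.zero) (∥-prodℕ (λ i → e (Fin.suc i)) (λ i → f (Fin.suc i)) (λ i → ∥f (Fin.suc i)))

  ∥-mono-∣ : ∀ {e f m n} → p^ e ∥ m → p^ f ∥ n → m ∣ n → e ≤ f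
  ∥-mono-∣ pᵉ∥m pᶠ∥n m∣n = ∥∧∣⇒≤ pᶠ∥n (∣-trans (∥⇒∣ pᵉ∥m) m∣n)

  p^∣*⇒p^∣ : ∀ e {r b} → ¬ p ∣ r → p ^ e ∣ r * b → p ^ e ∣ b
  p^∣*⇒p^∣ zero    _ _ = 1∣ _
  p^∣*⇒p^∣ (suc e) {r} {b} p∤r p^[1+e]∣rb with euclidsLemma r b p-prime (∣-trans (m∣m*n (p ^ e)) p^[1+e]∣rb)
  ... | inj₁ p∣r = contradiction p∣r p∤r
  ... | inj₂ (divides c refl) = subst (_∣ c * p) (*-comm (p ^ e) p) (*-monoˡ-∣ p p^e∣c)
    where
    p^e∣c : p ^ e ∣ c
    p^e∣c = p^∣*⇒p^∣ e p∤r (*-cancelˡ-∣ p (subst (p * p ^ e ∣_) (rotate r c p) p^[1+e]∣rb))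
      where
      rotate : ∀ x y z → x * (y * z) ≡ z * (x * y)
      rotate = solve-∀

  ∥-exists : ∀ n → 1 ≤ n → ∃[ e ] p^ e ∥ n
  ∥-exists n = go n (<-wellFounded n)
    where
    go : ∀ n → Acc _<_ n → 1 ≤ n → ∃[ e ] p^ e ∥ n
    go n (acc rec) 1≤n with p ∣? n
    ... | no p∤n = 0 , exactly n (sym (+-identityʳ n)) p∤n
    ... | yes (divides zero refl) = contradiction 1≤n (λ ())
    ... | yes (divides q@(suc _) refl) with go q (rec (m<m*n q p 1<p)) (s≤s z≤n)
    ...   | e , exactly r q≡pᵉr p∤r = suc e , exactly r (trans (cong (_* p) q≡pᵉr) (rotate (p ^ e) r p)) p∤r
      where
      rotate : ∀ a b c → a * b * c ≡ c * a * b
      rotate = solve-∀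

  ∥⇒^≤ : ∀ {e n} → p^ e ∥ n → p ^ e ≤ n
  ∥⇒^≤ {e} (exactly r refl p∤r) = m≤m*n (p ^ e) r {{ℕ.>-nonZero (p∤⇒1≤ p∤r)}}

  infixl 7 _/p^_
  _/p^_ : ℕ → ℕ → ℕ
  n /p^ s = _/_ n (p ^ s) {{m^n≢0 p s}}

  legendreSum : ℕ → ℕ → ℕ
  legendreSum zero    n = 0
  legendreSum (suc K) n = legendreSum K n + n /p^ suc K

  legendreSum-0 : ∀ K → legendreSum K 0 ≡ 0
  legendreSum-0 zero    = refl
  legendreSum-0 (suc K) = trans (cong (_+ 0 /p^ suc K) (legendreSum-0 K)) (0/n≡0 (p ^ suc K) {{m^n≢0 p (suc K)}})

  legendreSum-suc : ∀ K {n e} → p^ e ∥ suc n → legendreSum K (suc n) ≡ legendreSum K n + K ℕ.⊓ e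
  legendreSum-suc zero    _ = refl
  legendreSum-suc (suc K) {n} {e} ∥1+n with /-suc n (p ^ suc K) {{m^n≢0 p (suc K)}}
  ... | inj₁ (p^[1+K]∣1+n , 1+n/p^[1+K]) = begin
      legendreSum K (suc n) + suc n /p^ suc K ≡⟨ cong₂ _+_ (legendreSum-suc K ∥1+n) 1+n/p^[1+K] ⟩
      L + K ℕ.⊓ e + suc (n /p^ suc K)          ≡⟨ cong (λ x → L + x + suc (n /p^ suc K)) (m≤n⇒m⊓n≡m (<⇒≤ 1+K≤e)) ⟩
      L + K + suc (n /p^ suc K)                ≡⟨ shift L K (n /p^ suc K) ⟩
      L + n /p^ suc K + suc K                  ≡⟨ cong (L + n /p^ suc K +_) (sym (m≤n⇒m⊓n≡m 1+K≤e)) ⟩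
      L + n /p^ suc K + suc K ℕ.⊓ e            ∎
    where
    open ≡-Reasoning
    L = legendreSum K n
    1+K≤e : suc K ≤ e
    1+K≤e = ∥∧∣⇒≤ ∥1+n p^[1+K]∣1+n
    shift : ∀ a b c → a + b + suc c ≡ a + c + suc b
    shift = solve-∀
  ... | inj₂ (p^[1+K]∤1+n , 1+n/p^[1+K]) = begin
      legendreSum K (suc n) + suc n /p^ suc K ≡⟨ cong₂ _+_ (legendreSum-suc K ∥1+n) 1+n/p^[1+K] ⟩
      L + K ℕ.⊓ e + n /p^ suc K                ≡⟨ cong (λ x → L + x + n /p^ suc K) (m≥n⇒m⊓n≡n e≤K) ⟩
      L + e + n /p^ suc K                      ≡⟨ swap L e (n /p^ suc K) ⟩
      L + n /p^ suc K + e                      ≡⟨ cong (L + n /p^ suc K +_) (sym (m≥n⇒m⊓n≡n (m≤n⇒m≤1+n e≤K))) ⟩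
      L + n /p^ suc K + suc K ℕ.⊓ e            ∎
    where
    open ≡-Reasoning
    L = legendreSum K n
    e≤K : e ≤ K
    e≤K with suc K ≤? e
    ... | yes 1+K≤e = contradiction (∣-trans (p^-monoʳ-∣ 1+K≤e) (∥⇒∣ ∥1+n)) p^[1+K]∤1+n
    ... | no 1+K≰e = ≤-pred (≰⇒> 1+K≰e)
    swap : ∀ a b c → a + b + c ≡ a + c + b
    swap = solve-∀

  legendreSum-mono : ∀ {k m} (a : Fin k → ℕ) (b : Fin m → ℕ) →
    (∀ s → sumℕ (λ j → b j /p^ s) ≤ sumℕ (λ i → a i /p^ s)) →
    ∀ K → sumℕ (λ j → legendreSum K (b j)) ≤ sumℕ (λ i → legendreSum K (a i))
  legendreSum-mono {k} {m} a b quotients≤ zero    = ≤-reflexive (trans (sumℕ-zero m) (sym (sumℕ-zero k)))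
  legendreSum-mono         a b quotients≤ (suc K) =
    subst₂ _≤_ (sym (sumℕ-+ (λ j → legendreSum K (b j)) (λ j → b j /p^ suc K)))
               (sym (sumℕ-+ (λ i → legendreSum K (a i)) (λ i → a i /p^ suc K)))
               (+-mono-≤ (legendreSum-mono a b quotients≤ K) (quotients≤ (suc K)))

  legendre : ∀ K n → n < p ^ suc K → p^ legendreSum K n ∥ n !
  legendre K zero    _ = exactly 1 (cong (λ x → p ^ x * 1) (sym (legendreSum-0 K))) p∤1
  legendre K (suc n) 1+n<p^[1+K] with ∥-exists (suc n) (s≤s z≤n)
  ... | e , ∥1+n = subst (λ x → p^ x ∥ suc n !) exponent
                         (∥-* ∥1+n (legendre K n (<-trans (n<1+n n) 1+n<p^[1+K])))
    where
    e≤K : e ≤ K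
    e≤K with e ≤? K
    ... | yes e≤K = e≤K
    ... | no e≰K = contradiction (≤-<-trans (^-monoʳ-≤ p (≰⇒> e≰K)) (≤-<-trans (∥⇒^≤ ∥1+n) 1+n<p^[1+K])) (<-irrefl refl)
    exponent : e + legendreSum K n ≡ legendreSum K (suc n)
    exponent = trans (+-comm e _) (trans (cong (legendreSum K n +_) (trans (sym (m≤n⇒m⊓n≡m e≤K)) (⊓-comm e K)))
                                         (sym (legendreSum-suc K ∥1+n)))

  legendre-p² : ∀ n → n < p * p → p^ n / p ∥ n !
  legendre-p² n n<pp = subst (λ e → p^ e ∥ n !) (/-congʳ {{m^n≢0 p 1}} (*-identityʳ p))
                             (legendre 1 n (subst (n <_) (cong (p *_) (sym (*-identityʳ p))) n<pp))


∃-prime-∣ : ∀ n → 2 ≤ n → ∃[ p ] Prime p × p ∣ n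
∃-prime-∣ n@(suc _) 2≤n = first (factors f) (isFactorisation f) (factorsPrime f)
  where
  open PrimeFactorisation
  f = factorise n
  first : (ps : List ℕ) → n ≡ product ps → All Prime ps → ∃[ p ] Prime p × p ∣ n
  first []       n≡1            _               = contradiction (sym n≡1) (λ 1≡n → <-irrefl 1≡n 2≤n)
  first (p ∷ ps) n≡p*Πps (p-prime ∷ _) = p , p-prime , divides (product ps) (trans n≡p*Πps (*-comm p (product ps)))

∃-prime> : ∀ B → ∃[ p ] Prime p × B < p
∃-prime> B with ∃-prime-∣ (B ! + 1) (+-monoˡ-≤ 1 (1≤n! B))
... | p , p-prime , p∣B!+1 with p ≤? B
...   | no p≰B = p , p-prime , ≰⇒> p≰B
...   | yes p≤B = contradiction (∣m+n∣m⇒∣n p∣B!+1 (∣-trans p∣p! (m≤n⇒m!∣n! p≤B))) p∤1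
  where
  open Valuation p p-prime
  p∣p! : p ∣ p !
  p∣p! = subst (λ x → x ∣ x !) (suc-pred p) (m∣m*n (ℕ.pred p !))

∣-by-prime-powers : ∀ a b → 1 ≤ a → (∀ p → Prime p → ∀ s → p ^ s ∣ a → p ^ s ∣ b) → a ∣ b
∣-by-prime-powers a b = go a (<-wellFounded a)
  where
  go : ∀ a → Acc _<_ a → 1 ≤ a → (∀ p → Prime p → ∀ s → p ^ s ∣ a → p ^ s ∣ b) → a ∣ b
  go a (acc rec) 1≤a p^∣a⇒p^∣b with 2 ≤? a
  ... | no 2≰a = subst (_∣ b) (≤-antisym 1≤a (≤-pred (≰⇒> 2≰a))) (1∣ b)
  ... | yes 2≤a with ∃-prime-∣ a 2≤a
  ...   | p , p-prime , p∣a with Valuation.∥-exists p p-prime a 1≤a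
  ...     | e , Valuation.exactly r a≡p^e*r p∤r = subst₂ _∣_ (sym a≡p^e*r) (sym (_∣_.equality r∣b)) (*-monoˡ-∣ r p^e∣c)
    where
    open Valuation p p-prime
    r∣a : r ∣ a
    r∣a = divides (p ^ e) a≡p^e*r
    1≤e : 1 ≤ e
    1≤e = n≢0⇒n>0 λ e≡0 → p∤r (subst (p ∣_) (trans a≡p^e*r (trans (cong (λ x → p ^ x * r) e≡0) (+-identityʳ r))) p∣a)
    1<p^e : 1 < p ^ e
    1<p^e = <-≤-trans 1<p (subst (_≤ p ^ e) (*-identityʳ p) (^-monoʳ-≤ p 1≤e))
    r<a : r < a
    r<a = subst (r <_) (trans (*-comm r (p ^ e)) (sym a≡p^e*r)) (m<m*n r (p ^ e) {{ℕ.>-nonZero (p∤⇒1≤ p∤r)}} 1<p^e)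
    r∣b : r ∣ b
    r∣b = go r (rec r<a) (p∤⇒1≤ p∤r) (λ q q-prime s q^s∣r → p^∣a⇒p^∣b q q-prime s (∣-trans q^s∣r r∣a))
    c = _∣_.quotient r∣b
    p^e∣c : p ^ e ∣ c
    p^e∣c = p^∣*⇒p^∣ e p∤r (subst (p ^ e ∣_) (trans (_∣_.equality r∣b) (*-comm c r))
              (p^∣a⇒p^∣b p p-prime e (subst (p ^ e ∣_) (sym a≡p^e*r) (m∣m*n r))))

n<b^n : ∀ b → 1 < b → ∀ n → n < b ^ n
n<b^n b 1<b zero    = s≤s z≤n
n<b^n b 1<b (suc n) = begin-strict
  suc n         ≤⟨ n<b^n b 1<b n ⟩
  b ^ n         <⟨ m<m*n (b ^ n) b {{ℕ.>-nonZero (≤-<-trans z≤n (n<b^n b 1<b n))}} 1<b ⟩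
  b ^ n * b     ≡⟨ *-comm (b ^ n) b ⟩
  b ^ suc n     ∎
  where open ≤-Reasoning

open import Data.Integer using (+_)

r<l⇒+r≢+r′+[1+δ]l : ∀ {r r′} δ l → r < l → + r ≢ + r′ ℤ.+ +[1+ δ ] ℤ.* + l
r<l⇒+r≢+r′+[1+δ]l {r} {r′} δ l r<l r≡r′+[1+δ]l = <⇒≱ r<l (begin
  l                 ≤⟨ m≤m+n l (δ * l) ⟩
  suc δ * l         ≤⟨ m≤n+m (suc δ * l) r′ ⟩
  r′ + suc δ * l    ≡⟨ sym (ℤ.+-injective (trans r≡r′+[1+δ]l (cong (ℤ._+_ (+ r′)) (sym (ℤ.pos-* (suc δ) l))))) ⟩
  r                 ∎)
  where open ≤-Reasoning

%ℕ-/ℕ-unique : ∀ a {r q} l .{{_ : NonZero l}} → r < l → a ≡ + r ℤ.+ q ℤ.* + l → a %ℕ l ≡ r × a /ℕ l ≡ q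
%ℕ-/ℕ-unique a {r} {q} l r<l a≡r+ql = compare (q′ ℤ.- q) (shift (+ r) q (+ r′) q′ (+ l) (trans (sym a≡r+ql) a≡r′+q′l)) refl
  where
  r′ = a %ℕ l
  q′ = a /ℕ l
  a≡r′+q′l : a ≡ + r′ ℤ.+ q′ ℤ.* + l
  a≡r′+q′l = ℤ.a≡a%ℕn+[a/ℕn]*n a l
  shift : ∀ x y x′ y′ L → x ℤ.+ y ℤ.* L ≡ x′ ℤ.+ y′ ℤ.* L → x ≡ x′ ℤ.+ (y′ ℤ.- y) ℤ.* L
  shift x y x′ y′ L eq = trans (move-right x y L) (trans (cong (ℤ._- y ℤ.* L) eq) (move-left x′ y′ y L))
    where
    move-right : ∀ x y L → x ≡ (x ℤ.+ y ℤ.* L) ℤ.- y ℤ.* L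
    move-right = ℤ-Ring.solve-∀
    move-left : ∀ x′ y′ y L → (x′ ℤ.+ y′ ℤ.* L) ℤ.- y ℤ.* L ≡ x′ ℤ.+ (y′ ℤ.- y) ℤ.* L
    move-left = ℤ-Ring.solve-∀
  compare : ∀ D → + r ≡ + r′ ℤ.+ D ℤ.* + l → q′ ℤ.- q ≡ D → r′ ≡ r × q′ ≡ q
  compare (+ zero)  r≡r′ q′-q≡0 = sym (ℤ.+-injective (trans r≡r′ (ℤ.+-identityʳ (+ r′)))) , difference-zero q′ q q′-q≡0
    where
    difference-zero : ∀ x y → x ℤ.- y ≡ + 0 → x ≡ y
    difference-zero x y x-y≡0 = trans (add-back x y) (trans (cong (ℤ._+ y) x-y≡0) (ℤ.+-identityˡ y))
      where
      add-back : ∀ x y → x ≡ (x ℤ.- y) ℤ.+ y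
      add-back = ℤ-Ring.solve-∀
  compare +[1+ δ ] r≡r′+[1+δ]l _ = ⊥-elim (r<l⇒+r≢+r′+[1+δ]l δ l r<l r≡r′+[1+δ]l)
  compare -[1+ δ ] r≡r′-[1+δ]l _ = ⊥-elim (r<l⇒+r≢+r′+[1+δ]l δ l (ℤ.n%ℕd<d a l) (flip (+ r) (+ r′) +[1+ δ ] (+ l) r≡r′-[1+δ]l))
    where
    flip : ∀ x x′ D L → x ≡ x′ ℤ.+ (ℤ.- D) ℤ.* L → x′ ≡ x ℤ.+ D ℤ.* L
    flip x x′ D L eq = trans (solve x′ D L) (cong (ℤ._+ D ℤ.* L) (sym eq))
      where
      solve : ∀ x′ D L → x′ ≡ (x′ ℤ.+ (ℤ.- D) ℤ.* L) ℤ.+ D ℤ.* L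
      solve = ℤ-Ring.solve-∀

infix 4 _≡_modℤ_
data _≡_modℤ_ (a b : ℤ) (l : ℕ) : Set where
  congruent : ∀ q → a ≡ b ℤ.+ q ℤ.* + l → a ≡ b modℤ l

module _ {l : ℕ} where

  ≡-modℤ-refl : ∀ {a} → a ≡ a modℤ l
  ≡-modℤ-refl {a} = congruent (+ 0) (plus-zero a (+ l))
    where
    plus-zero : ∀ a L → a ≡ a ℤ.+ + 0 ℤ.* L
    plus-zero = ℤ-Ring.solve-∀

  ≡-modℤ-+ : ∀ {a b c e} → a ≡ b modℤ l → c ≡ e modℤ l → a ℤ.+ c ≡ b ℤ.+ e modℤ l
  ≡-modℤ-+ {b = b} {e = e} (congruent q a≡b+ql) (congruent q′ c≡e+q′l) =
    congruent (q ℤ.+ q′) (trans (cong₂ ℤ._+_ a≡b+ql c≡e+q′l) (regroup b q e q′ (+ l)))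
    where
    regroup : ∀ b q e q′ L → (b ℤ.+ q ℤ.* L) ℤ.+ (e ℤ.+ q′ ℤ.* L) ≡ (b ℤ.+ e) ℤ.+ (q ℤ.+ q′) ℤ.* L
    regroup = ℤ-Ring.solve-∀

  ≡-modℤ-neg : ∀ {a b} → a ≡ b modℤ l → ℤ.- a ≡ ℤ.- b modℤ l
  ≡-modℤ-neg {b = b} (congruent q a≡b+ql) = congruent (ℤ.- q) (trans (cong ℤ.-_ a≡b+ql) (negate b q (+ l)))
    where
    negate : ∀ b q L → ℤ.- (b ℤ.+ q ℤ.* L) ≡ ℤ.- b ℤ.+ (ℤ.- q) ℤ.* L
    negate = ℤ-Ring.solve-∀

  ≡-modℤ-*ˡ : ∀ c {a b} → a ≡ b modℤ l → c ℤ.* a ≡ c ℤ.* b modℤ l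
  ≡-modℤ-*ˡ c {b = b} (congruent q a≡b+ql) = congruent (c ℤ.* q) (trans (cong (c ℤ.*_) a≡b+ql) (distribute c b q (+ l)))
    where
    distribute : ∀ c b q L → c ℤ.* (b ℤ.+ q ℤ.* L) ≡ c ℤ.* b ℤ.+ (c ℤ.* q) ℤ.* L
    distribute = ℤ-Ring.solve-∀

  sumℤ-≡-modℤ : ∀ {n} {f g : Fin n → ℤ} → (∀ i → f i ≡ g i modℤ l) → sumℤ f ≡ sumℤ g modℤ l
  sumℤ-≡-modℤ {zero}  _   = ≡-modℤ-refl
  sumℤ-≡-modℤ {suc n} f≡g = ≡-modℤ-+ (f≡g Fin.zero) (sumℤ-≡-modℤ (λ i → f≡g (Fin.suc i)))

  module _ .{{_ : NonZero l}} where

    ≡%ℕ-modℤ : ∀ a → a ≡ + (a %ℕ l) modℤ l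
    ≡%ℕ-modℤ a = congruent (a /ℕ l) (ℤ.a≡a%ℕn+[a/ℕn]*n a l)

    %ℕ-cong : ∀ {a b} → a ≡ b modℤ l → a %ℕ l ≡ b %ℕ l
    %ℕ-cong {a} {b} (congruent q a≡b+ql) = proj₁ (%ℕ-/ℕ-unique a {q = b /ℕ l ℤ.+ q} l (ℤ.n%ℕd<d b l)
      (trans a≡b+ql (trans (cong (λ x → x ℤ.+ q ℤ.* + l) (ℤ.a≡a%ℕn+[a/ℕn]*n b l))
                           (regroup (+ (b %ℕ l)) (b /ℕ l) q (+ l)))))
      where
      regroup : ∀ r p q L → (r ℤ.+ p ℤ.* L) ℤ.+ q ℤ.* L ≡ r ℤ.+ (p ℤ.+ q) ℤ.* L
      regroup = ℤ-Ring.solve-∀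

    neg-%ℕ : ∀ x → (ℤ.- + x) %ℕ l ≡ (l ∸ x % l) % l
    neg-%ℕ zero    = trans (0%n≡0 l) (sym (trans (cong (λ r → (l ∸ r) % l) (0%n≡0 l)) (n%n≡0 l)))
    neg-%ℕ (suc x) with suc x % l in r≡
    ... | zero  = sym (n%n≡0 l)
    ... | suc r = sym (m<n⇒m%n≡m (∸-monoʳ-< (s≤s z≤n) (subst (_≤ l) r≡ (m%n≤n (suc x) l))))

toℚᵘ-/ : ∀ a n → ℚ.toℚᵘ (a ℚ./ suc n) ℚᵘ.≃ mkℚᵘ a n
toℚᵘ-/ a n = ℚ.toℚᵘ-fromℚᵘ (mkℚᵘ a n)

floor-/ : ∀ a n → floor (a ℚ./ suc n) ≡ a /ℕ suc n
floor-/ a n = trans (floor≡↥/ℕ↧ x) (sym (proj₂ (%ℕ-/ℕ-unique a {q = N /ℕ D} l r·g<l a≡r·g+[N/D]l)))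
  where
  l = suc n
  x = a ℚ./ l
  N = ℚ.↥ x
  D = ℚ.ℚ.denominatorℕ x
  g = ℕ.gcd ℤ.∣ a ∣ l
  r = N %ℕ D
  floor≡↥/ℕ↧ : ∀ y → floor y ≡ ℚ.↥ y /ℕ ℚ.ℚ.denominatorℕ y
  floor≡↥/ℕ↧ (ℚ.mkℚ N d _) = ℤ.div-pos-is-/ℕ N (suc d)
  D·g≡l : D * g ≡ l
  D·g≡l = ℤ.+-injective (trans (ℤ.pos-* D g) (ℚ.↧-/ a l))
  r·g<l : r * g < l
  r·g<l = subst (r * g <_) D·g≡l (*-monoˡ-< g {{ℕ.≢-nonZero g≢0}} (ℤ.n%ℕd<d N D))
    where
    g≢0 : g ≢ 0
    g≢0 g≡0 = 0≢1+n (trans (sym (*-zeroʳ D)) (trans (cong (D *_) (sym g≡0)) D·g≡l))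
  a≡r·g+[N/D]l : a ≡ + (r * g) ℤ.+ (N /ℕ D) ℤ.* + l
  a≡r·g+[N/D]l = begin
    a                                         ≡⟨ sym (ℚ.↥-/ a l) ⟩
    N ℤ.* + g                                 ≡⟨ cong (ℤ._* + g) (ℤ.a≡a%ℕn+[a/ℕn]*n N D) ⟩
    (+ r ℤ.+ N /ℕ D ℤ.* + D) ℤ.* + g          ≡⟨ distribute (+ r) (N /ℕ D) (+ D) (+ g) ⟩
    + r ℤ.* + g ℤ.+ N /ℕ D ℤ.* (+ D ℤ.* + g)  ≡⟨ cong₂ (λ s t → s ℤ.+ N /ℕ D ℤ.* t) (sym (ℤ.pos-* r g)) (trans (sym (ℤ.pos-* D g)) (cong +_ D·g≡l)) ⟩
    + (r * g) ℤ.+ N /ℕ D ℤ.* + l              ∎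
    where
    open ≡-Reasoning
    distribute : ∀ r q d g → (r ℤ.+ q ℤ.* d) ℤ.* g ≡ r ℤ.* g ℤ.+ q ℤ.* (d ℤ.* g)
    distribute = ℤ-Ring.solve-∀

frac-/ : ∀ a n → frac (a ℚ./ suc n) ≡ + (a %ℕ suc n) ℚ./ suc n
frac-/ a n = ℚ.toℚᵘ-injective toℚᵘ-frac
  where
  l = suc n
  x = a ℚ./ l
  F = floor x
  r = a %ℕ l
  cross-multiplied : (a ℤ.* + 1 ℤ.+ ℤ.- F ℤ.* + l) ℤ.* + l ≡ + r ℤ.* + (l * 1)
  cross-multiplied = begin
    (a ℤ.* + 1 ℤ.+ ℤ.- F ℤ.* + l) ℤ.* + l                   ≡⟨ cong (λ y → (y ℤ.* + 1 ℤ.+ ℤ.- F ℤ.* + l) ℤ.* + l) a≡r+Fl ⟩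
    ((+ r ℤ.+ F ℤ.* + l) ℤ.* + 1 ℤ.+ ℤ.- F ℤ.* + l) ℤ.* + l  ≡⟨ cancel (+ r) F (+ l) ⟩
    + r ℤ.* + l                                               ≡⟨ cong (λ m → + r ℤ.* + m) (sym (*-identityʳ l)) ⟩
    + r ℤ.* + (l * 1)                                         ∎
    where
    open ≡-Reasoning
    a≡r+Fl : a ≡ + r ℤ.+ F ℤ.* + l
    a≡r+Fl = trans (ℤ.a≡a%ℕn+[a/ℕn]*n a l) (cong (λ q → + r ℤ.+ q ℤ.* + l) (sym (floor-/ a n)))
    cancel : ∀ r F L → ((r ℤ.+ F ℤ.* L) ℤ.* + 1 ℤ.+ ℤ.- F ℤ.* L) ℤ.* L ≡ r ℤ.* L
    cancel = ℤ-Ring.solve-∀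
  toℚᵘ-frac : ℚ.toℚᵘ (x ℚ.- F ℚ./ 1) ℚᵘ.≃ ℚ.toℚᵘ (+ r ℚ./ l)
  toℚᵘ-frac = begin
    ℚ.toℚᵘ (x ℚ.- F ℚ./ 1)                 ≈⟨ ℚ.toℚᵘ-homo-+ x (ℚ.- (F ℚ./ 1)) ⟩
    ℚ.toℚᵘ x ℚᵘ.+ ℚ.toℚᵘ (ℚ.- (F ℚ./ 1))  ≈⟨ ℚᵘ.+-cong (toℚᵘ-/ a n) (ℚᵘ.≃-trans (ℚ.toℚᵘ-homo‿- (F ℚ./ 1)) (ℚᵘ.-‿cong (toℚᵘ-/ F 0))) ⟩
    mkℚᵘ a n ℚᵘ.+ mkℚᵘ (ℤ.- F) 0          ≈⟨ *≡* cross-multiplied ⟩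
    mkℚᵘ (+ r) n                           ≈⟨ ℚᵘ.≃-sym (toℚᵘ-/ (+ r) n) ⟩
    ℚ.toℚᵘ (+ r ℚ./ l)                     ∎
    where open ℚᵘ.≃-Reasoning

*-/ : ∀ t x n → (+ t ℚ./ 1) ℚ.* (+ x ℚ./ suc n) ≡ + (t * x) ℚ./ suc n
*-/ t x n = ℚ.toℚᵘ-injective (begin
  ℚ.toℚᵘ ((+ t ℚ./ 1) ℚ.* (+ x ℚ./ suc n))             ≈⟨ ℚ.toℚᵘ-homo-* (+ t ℚ./ 1) (+ x ℚ./ suc n) ⟩
  ℚ.toℚᵘ (+ t ℚ./ 1) ℚᵘ.* ℚ.toℚᵘ (+ x ℚ./ suc n)       ≈⟨ ℚᵘ.*-cong (toℚᵘ-/ (+ t) 0) (toℚᵘ-/ (+ x) n) ⟩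
  mkℚᵘ (+ t) 0 ℚᵘ.* mkℚᵘ (+ x) n                        ≈⟨ *≡* (cong₂ ℤ._*_ (sym (ℤ.pos-* t x)) (cong +_ (sym (+-identityʳ (suc n))))) ⟩
  mkℚᵘ (+ (t * x)) n                                    ≈⟨ ℚᵘ.≃-sym (toℚᵘ-/ (+ (t * x)) n) ⟩
  ℚ.toℚᵘ (+ (t * x) ℚ./ suc n)                          ∎)
  where open ℚᵘ.≃-Reasoning

+-/ : ∀ x y n → (+ x ℚ./ suc n) ℚ.+ (+ y ℚ./ suc n) ≡ + (x + y) ℚ./ suc n
+-/ x y n = ℚ.toℚᵘ-injective (begin
  ℚ.toℚᵘ ((+ x ℚ./ suc n) ℚ.+ (+ y ℚ./ suc n))         ≈⟨ ℚ.toℚᵘ-homo-+ (+ x ℚ./ suc n) (+ y ℚ./ suc n) ⟩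
  ℚ.toℚᵘ (+ x ℚ./ suc n) ℚᵘ.+ ℚ.toℚᵘ (+ y ℚ./ suc n)   ≈⟨ ℚᵘ.+-cong (toℚᵘ-/ (+ x) n) (toℚᵘ-/ (+ y) n) ⟩
  mkℚᵘ (+ x) n ℚᵘ.+ mkℚᵘ (+ y) n                        ≈⟨ *≡* cross-multiplied ⟩
  mkℚᵘ (+ (x + y)) n                                    ≈⟨ ℚᵘ.≃-sym (toℚᵘ-/ (+ (x + y)) n) ⟩
  ℚ.toℚᵘ (+ (x + y) ℚ./ suc n)                          ∎)
  where
  open ℚᵘ.≃-Reasoning
  L = + suc n
  factor : ∀ x y L → (x ℤ.* L ℤ.+ y ℤ.* L) ℤ.* L ≡ (x ℤ.+ y) ℤ.* (L ℤ.* L)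
  factor = ℤ-Ring.solve-∀
  cross-multiplied : (+ x ℤ.* L ℤ.+ + y ℤ.* L) ℤ.* L ≡ + (x + y) ℤ.* + (suc n * suc n)
  cross-multiplied = trans (factor (+ x) (+ y) L) (cong₂ ℤ._*_ (sym (ℤ.pos-+ x y)) (sym (ℤ.pos-* (suc n) (suc n))))

sumℚ-/ : ∀ {N} (f : Fin N → ℕ) n → sumℚ (λ j → + f j ℚ./ suc n) ≡ + sumℕ f ℚ./ suc n
sumℚ-/ {zero}  f n = sym (ℚ.0/n≡0 (suc n))
sumℚ-/ {suc N} f n = trans (cong (ℚ._+_ (+ f Fin.zero ℚ./ suc n)) (sumℚ-/ (λ j → f (Fin.suc j)) n))
                           (+-/ (f Fin.zero) _ n)

sumℚ-cong : ∀ {N} {f g : Fin N → ℚ} → (∀ j → f j ≡ g j) → sumℚ f ≡ sumℚ g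
sumℚ-cong {zero}  _   = refl
sumℚ-cong {suc N} f≡g = cong₂ ℚ._+_ (f≡g Fin.zero) (sumℚ-cong (λ j → f≡g (Fin.suc j)))

/≡0⇒≡0 : ∀ x n → + x ℚ./ suc n ≡ 0ℚ → x ≡ 0
/≡0⇒≡0 x n x/l≡0 = m*n≡0⇒m≡0 x (suc n) (ℤ.+-injective (trans (ℤ.pos-* x (suc n)) cross-multiplied))
  where
  cross-multiplied : + x ℤ.* + suc n ≡ + 0 ℤ.* + suc n
  cross-multiplied with ℚᵘ.≃-trans (ℚᵘ.≃-sym (toℚᵘ-/ (+ x) n))
                         (ℚᵘ.≃-trans (ℚ.toℚᵘ-cong (trans x/l≡0 (sym (ℚ.0/n≡0 (suc n))))) (toℚᵘ-/ (+ 0) n))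
  ... | *≡* eq = eq

≤-/⇔ : ∀ k x n → (+ k ℚ./ 1) ℚ.≤ (+ x ℚ./ suc n) ⇔ k * suc n ≤ x
≤-/⇔ k x n = mk⇔ to from
  where
  to : (+ k ℚ./ 1) ℚ.≤ (+ x ℚ./ suc n) → k * suc n ≤ x
  to k≤x/l with ℚᵘ.≤-respʳ-≃ (toℚᵘ-/ (+ x) n) (ℚᵘ.≤-respˡ-≃ (toℚᵘ-/ (+ k) 0) (ℚ.toℚᵘ-mono-≤ k≤x/l))
  ... | *≤* kl≤x·1 = subst (k * suc n ≤_) (*-identityʳ x)
                       (ℤ.drop‿+≤+ (subst₂ ℤ._≤_ (sym (ℤ.pos-* k (suc n))) (sym (ℤ.pos-* x 1)) kl≤x·1))
  from : k * suc n ≤ x → (+ k ℚ./ 1) ℚ.≤ (+ x ℚ./ suc n)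
  from kl≤x = ℚ.toℚᵘ-cancel-≤ (ℚᵘ.≤-respʳ-≃ (ℚᵘ.≃-sym (toℚᵘ-/ (+ x) n)) (ℚᵘ.≤-respˡ-≃ (ℚᵘ.≃-sym (toℚᵘ-/ (+ k) 0))
    (*≤* (subst₂ ℤ._≤_ (ℤ.pos-* k (suc n)) (ℤ.pos-* x 1) (ℤ.+≤+ (subst (k * suc n ≤_) (sym (*-identityʳ x)) kl≤x))))))

evalℕ-mono-≤ : ∀ {d} (c : LinForm d) {Y Z : Fin d → ℕ} → (∀ j → Y j ≤ Z j) → evalℕ c Y ≤ evalℕ c Z
evalℕ-mono-≤ c Y≤Z = sumℕ-mono-≤ (λ j → *-monoʳ-≤ (c j) (Y≤Z j))

evalℕ-+ : ∀ {d} (c : LinForm d) (Y Z : Fin d → ℕ) → evalℕ c (λ j → Y j + Z j) ≡ evalℕ c Y + evalℕ c Z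
evalℕ-+ c Y Z = trans (sumℕ-cong (λ j → *-distribˡ-+ (c j) (Y j) (Z j))) (sumℕ-+ (λ j → c j * Y j) (λ j → c j * Z j))

evalℕ-*ʳ : ∀ {d} (c : LinForm d) (Y : Fin d → ℕ) t → evalℕ c (λ j → Y j * t) ≡ evalℕ c Y * t
evalℕ-*ʳ c Y t = trans (sumℕ-cong (λ j → sym (*-assoc (c j) (Y j) t))) (sumℕ-*ʳ (λ j → c j * Y j) t)

evalℕ-*ˡ : ∀ {d} (c : LinForm d) t (Y : Fin d → ℕ) → evalℕ c (λ j → t * Y j) ≡ t * evalℕ c Y
evalℕ-*ˡ c t Y = trans (sumℕ-cong (λ j → cong (c j *_) (*-comm t (Y j))))
                       (trans (evalℕ-*ʳ c Y t) (*-comm _ t))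

evalℕ-const : ∀ {d} (c : LinForm d) x → evalℕ c (λ _ → x) ≡ sumℕ c * x
evalℕ-const c x = sumℕ-*ʳ c x

evalℕ-%-cong : ∀ {d} (c : LinForm d) {Y Z : Fin d → ℕ} l .{{_ : NonZero l}} →
  (∀ j → Y j % l ≡ Z j % l) → evalℕ c Y % l ≡ evalℕ c Z % l
evalℕ-%-cong c {Y} {Z} l Y≡Z = sumℕ-%-cong l λ j → begin
  c j * Y j % l             ≡⟨ %-distribˡ-* (c j) (Y j) l ⟩
  c j % l * (Y j % l) % l   ≡⟨ cong (λ y → c j % l * y % l) (Y≡Z j) ⟩
  c j % l * (Z j % l) % l   ≡⟨ sym (%-distribˡ-* (c j) (Z j) l) ⟩
  c j * Z j % l             ∎
  where open ≡-Reasoning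

sumℕ-evalℕ : ∀ {d n} (w : Fin n → LinForm d) Y → sumℕ (λ i → evalℕ (w i) Y) ≡ evalℕ (λ j → sumℕ (λ i → w i j)) Y
sumℕ-evalℕ w Y = trans (sumℕ-swap (λ i j → w i j * Y j)) (sumℕ-cong (λ j → sumℕ-*ʳ (λ i → w i j) (Y j)))

evalℤ-+ : ∀ {d} (c : LinForm d) (Y : Fin d → ℕ) → evalℤ c (λ j → + Y j) ≡ + evalℕ c Y
evalℤ-+ {zero}  c Y = refl
evalℤ-+ {suc d} c Y = trans (cong₂ ℤ._+_ (sym (ℤ.pos-* (c Fin.zero) (Y Fin.zero))) (evalℤ-+ (λ j → c (Fin.suc j)) (λ j → Y (Fin.suc j))))
                            (sym (ℤ.pos-+ (c Fin.zero * Y Fin.zero) _))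

evalℤ-≡-modℤ : ∀ {d} (c : LinForm d) (X : Fin d → ℤ) l .{{_ : NonZero l}} →
  evalℤ c X ≡ + evalℕ c (λ j → X j %ℕ l) modℤ l
evalℤ-≡-modℤ c X l = subst (λ y → evalℤ c X ≡ y modℤ l) (evalℤ-+ c (λ j → X j %ℕ l))
                            (sumℤ-≡-modℤ (λ j → ≡-modℤ-*ˡ (+ c j) (≡%ℕ-modℤ (X j))))

-- Landau's criterion

module Balanced {d k m} (u : Fin k → LinForm d) (v : Fin m → LinForm d)
                (balanced : ∀ j → sumℕ (λ i → u i j) ≡ sumℕ (λ i → v i j)) where

  sumℕ-evalℕ-balanced : ∀ Y → sumℕ (λ i → evalℕ (u i) Y) ≡ sumℕ (λ j → evalℕ (v j) Y)
  sumℕ-evalℕ-balanced Y = trans (sumℕ-evalℕ u Y) (trans (sumℕ-cong (λ j → cong (_* Y j) (balanced j)))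
                                                          (sym (sumℕ-evalℕ v Y)))

  sumℕ-weights-balanced : sumℕ (λ i → sumℕ (u i)) ≡ sumℕ (λ j → sumℕ (v j))
  sumℕ-weights-balanced = trans (sumℕ-swap u) (trans (sumℕ-cong balanced) (sym (sumℕ-swap v)))

  ResidueIneq : (Fin d → ℕ) → (l : ℕ) → .{{_ : NonZero l}} → Set
  ResidueIneq Y l = sumℕ (λ i → evalℕ (u i) Y % l) ≤ sumℕ (λ j → evalℕ (v j) Y % l)

  LandauCriterion : Set
  LandauCriterion = ∀ Y l .{{_ : NonZero l}} → ResidueIneq Y l

  GenericLandauCriterion : Set
  GenericLandauCriterion = ∀ Y l .{{_ : NonZero l}} → 2 ≤ l →
    (∀ i → evalℕ (u i) Y % l ≢ 0) → (∀ j → evalℕ (v j) Y % l ≢ 0) → ResidueIneq Y l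

  residueIneq⇒quotientIneq : ∀ Y l .{{_ : NonZero l}} → ResidueIneq Y l →
    sumℕ (λ j → evalℕ (v j) Y / l) ≤ sumℕ (λ i → evalℕ (u i) Y / l)
  residueIneq⇒quotientIneq Y l =
    BalancedSums.remainders≤⇒quotients≥ (λ i → evalℕ (u i) Y) (λ j → evalℕ (v j) Y) (sumℕ-evalℕ-balanced Y) l

  quotientIneq⇒residueIneq : ∀ Y l .{{_ : NonZero l}} →
    sumℕ (λ j → evalℕ (v j) Y / l) ≤ sumℕ (λ i → evalℕ (u i) Y / l) → ResidueIneq Y l
  quotientIneq⇒residueIneq Y l =
    BalancedSums.quotients≥⇒remainders≤ (λ i → evalℕ (u i) Y) (λ j → evalℕ (v j) Y) (sumℕ-evalℕ-balanced Y) l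

  total-weight : ℕ
  total-weight = sumℕ (λ i → sumℕ (u i)) + sumℕ (λ j → sumℕ (v j))

  weight-u≤total : ∀ i → sumℕ (u i) ≤ total-weight
  weight-u≤total i = ≤-trans (lookup≤sumℕ (λ i → sumℕ (u i)) i) (m≤m+n _ _)

  weight-v≤total : ∀ j → sumℕ (v j) ≤ total-weight
  weight-v≤total j = ≤-trans (lookup≤sumℕ (λ j → sumℕ (v j)) j) (m≤n+m _ _)

  residueIneq-%-cong : ∀ {Y Z} l .{{_ : NonZero l}} → (∀ j → Y j % l ≡ Z j % l) → ResidueIneq Y l → ResidueIneq Z l
  residueIneq-%-cong l Y≡Z = subst₂ _≤_ (sumℕ-cong (λ i → evalℕ-%-cong (u i) l Y≡Z))
                                        (sumℕ-cong (λ j → evalℕ-%-cong (v j) l Y≡Z))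

  -- X = ⌈p Y / l⌉ with p > 2 l · (total weight): then ⌊c(X)/p⌋ = ⌊c(Y)/l⌋ and c(X) < p², so the
  -- p-adic valuation of c(X)! is ⌊c(Y)/l⌋.
  cond1⇒residueIneq-bounded : Cond1 d k m u v → ∀ Y l .{{_ : NonZero l}} →
    (∀ j → 1 ≤ Y j) → (∀ j → Y j ≤ l + l) → ResidueIneq Y l
  cond1⇒residueIneq-bounded cond1 Y l 1≤Y Y≤2l with ∃-prime> (total-weight * (l + l))
  ... | p , p-prime , W[2l]<p = quotientIneq⇒residueIneq Y l
          (subst₂ _≤_ (sumℕ-cong (λ j → c[X]/p≡c[Y]/l (v j) (weight-v≤total j)))
                      (sumℕ-cong (λ i → c[X]/p≡c[Y]/l (u i) (weight-u≤total i)))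
                      (∥-mono-∣ (∥-prodℕ _ _ (λ j → legendre-c[X] (v j) (weight-v≤total j)))
                                (∥-prodℕ _ _ (λ i → legendre-c[X] (u i) (weight-u≤total i)))
                                (cond1 X 1≤X)))
    where
    open Valuation p p-prime
    X : Fin d → ℕ
    X j = (p * Y j + ℕ.pred l) / l
    pY≤Xl : ∀ j → p * Y j ≤ X j * l
    pY≤Xl j = +-cancelʳ-≤ (ℕ.pred l) _ _ (begin
      p * Y j + ℕ.pred l                       ≡⟨ m≡m%n+[m/n]*n (p * Y j + ℕ.pred l) l ⟩
      (p * Y j + ℕ.pred l) % l + X j * l       ≤⟨ +-monoˡ-≤ (X j * l) (<⇒≤pred (m%n<n _ l)) ⟩
      ℕ.pred l + X j * l                       ≡⟨ +-comm (ℕ.pred l) _ ⟩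
      X j * l + ℕ.pred l                       ∎)
      where open ≤-Reasoning
    Xl≤pY+pred[l] : ∀ j → X j * l ≤ p * Y j + ℕ.pred l
    Xl≤pY+pred[l] j = m/n*n≤m _ l
    1≤X : ∀ j → 1 ≤ X j
    1≤X j with X j | pY≤Xl j
    ... | zero  | pY≤0 = contradiction (≤-trans (*-mono-≤ (<⇒≤ 1<p) (1≤Y j)) pY≤0) λ ()
    ... | suc _ | _    = s≤s z≤n
    module _ (c : LinForm d) (w≤W : sumℕ c ≤ total-weight) where
      pc[Y]≤c[X]l : p * evalℕ c Y ≤ evalℕ c X * l
      pc[Y]≤c[X]l = begin
        p * evalℕ c Y                ≡⟨ sym (evalℕ-*ˡ c p Y) ⟩
        evalℕ c (λ j → p * Y j)      ≤⟨ evalℕ-mono-≤ c pY≤Xl ⟩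
        evalℕ c (λ j → X j * l)      ≡⟨ evalℕ-*ʳ c X l ⟩
        evalℕ c X * l                ∎
        where open ≤-Reasoning
      c[X]l≤pc[Y]+w·pred[l] : evalℕ c X * l ≤ p * evalℕ c Y + sumℕ c * ℕ.pred l
      c[X]l≤pc[Y]+w·pred[l] = begin
        evalℕ c X * l                                   ≡⟨ sym (evalℕ-*ʳ c X l) ⟩
        evalℕ c (λ j → X j * l)                         ≤⟨ evalℕ-mono-≤ c Xl≤pY+pred[l] ⟩
        evalℕ c (λ j → p * Y j + ℕ.pred l)              ≡⟨ evalℕ-+ c (λ j → p * Y j) (λ _ → ℕ.pred l) ⟩
        evalℕ c (λ j → p * Y j) + evalℕ c (λ _ → ℕ.pred l) ≡⟨ cong₂ _+_ (evalℕ-*ˡ c p Y) (evalℕ-const c (ℕ.pred l)) ⟩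
        p * evalℕ c Y + sumℕ c * ℕ.pred l               ∎
        where open ≤-Reasoning
      w·pred[l]<p : sumℕ c * ℕ.pred l < p
      w·pred[l]<p = ≤-<-trans (*-mono-≤ w≤W (≤-trans pred[n]≤n (m≤m+n l l))) W[2l]<p
      c[X]/p≡c[Y]/l : evalℕ c X / p ≡ evalℕ c Y / l
      c[X]/p≡c[Y]/l = /-transfer p l pc[Y]≤c[X]l c[X]l≤pc[Y]+w·pred[l] w·pred[l]<p
      c[Y]<pl : evalℕ c Y < p * l
      c[Y]<pl = begin-strict
        evalℕ c Y                   ≤⟨ evalℕ-mono-≤ c Y≤2l ⟩
        evalℕ c (λ _ → l + l)       ≡⟨ evalℕ-const c (l + l) ⟩
        sumℕ c * (l + l)            ≤⟨ *-monoˡ-≤ (l + l) w≤W ⟩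
        total-weight * (l + l)      <⟨ W[2l]<p ⟩
        p                           ≤⟨ m≤m*n p l ⟩
        p * l                       ∎
        where open ≤-Reasoning
      legendre-c[X] : p^ (evalℕ c X / p) ∥ evalℕ c X !
      legendre-c[X] = legendre-p² (evalℕ c X) (m/n<o⇒m<o*n (subst (_< p) (sym c[X]/p≡c[Y]/l) (m<n*o⇒m/o<n c[Y]<pl)))

  cond1⇒landau : Cond1 d k m u v → LandauCriterion
  cond1⇒landau cond1 Y l = residueIneq-%-cong l Y′≡Y (cond1⇒residueIneq-bounded cond1 Y′ l 1≤Y′ Y′≤2l)
    where
    Y′ : Fin d → ℕ
    Y′ j = Y j % l + l
    1≤Y′ : ∀ j → 1 ≤ Y′ j
    1≤Y′ j = ≤-trans (ℕ.>-nonZero⁻¹ l) (m≤n+m l _)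
    Y′≤2l : ∀ j → Y′ j ≤ l + l
    Y′≤2l j = +-monoˡ-≤ l (m%n≤n (Y j) l)
    Y′≡Y : ∀ j → Y′ j % l ≡ Y j % l
    Y′≡Y j = trans ([m+n]%n≡m%n (Y j % l) l) (m%n%n≡m%n (Y j) l)

  landau⇒cond1 : LandauCriterion → Cond1 d k m u v
  landau⇒cond1 landau X _ = ∣-by-prime-powers _ _ (1≤prodℕ (λ j → b j !) (λ j → 1≤n! (b j))) p^∣Πb!⇒p^∣Πa!
    where
    a : Fin k → ℕ
    a i = evalℕ (u i) X
    b : Fin m → ℕ
    b j = evalℕ (v j) X
    p^∣Πb!⇒p^∣Πa! : ∀ p → Prime p → ∀ s → p ^ s ∣ prodℕ (λ j → b j !) → p ^ s ∣ prodℕ (λ i → a i !)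
    p^∣Πb!⇒p^∣Πa! p p-prime s p^s∣Πb! =
      ∣-trans (p^-monoʳ-∣ (≤-trans (∥∧∣⇒≤ {s = s} ∥Πb! p^s∣Πb!) legendreSums≤)) (∥⇒∣ ∥Πa!)
      where
      open Valuation p p-prime
      K = sumℕ a + sumℕ b
      below : ∀ {n} → n ≤ K → n < p ^ suc K
      below n≤K = <-trans (s≤s n≤K) (n<b^n p 1<p (suc K))
      ∥Πa! = ∥-prodℕ _ _ (λ i → legendre K (a i) (below (≤-trans (lookup≤sumℕ a i) (m≤m+n _ _))))
      ∥Πb! = ∥-prodℕ _ _ (λ j → legendre K (b j) (below (≤-trans (lookup≤sumℕ b j) (m≤n+m _ _))))
      legendreSums≤ : sumℕ (λ j → legendreSum K (b j)) ≤ sumℕ (λ i → legendreSum K (a i))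
      legendreSums≤ = legendreSum-mono a b (λ s → residueIneq⇒quotientIneq X (p ^ s) {{m^n≢0 p s}}
                                                     (landau X (p ^ s) {{m^n≢0 p s}})) K

  -- Modulo l·N the value c(N·Y + 1) = c(Y)·N + weight(c) has residue (c(Y) mod l)·N + weight(c),
  -- which is non-zero and determines c(Y) mod l because 0 < weight(c) < N.
  genericLandau⇒landau : 1 ≤ d → (∀ i j → 1 ≤ u i j) → (∀ i j → 1 ≤ v i j) →
                         GenericLandauCriterion → LandauCriterion
  genericLandau⇒landau 1≤d 1≤u 1≤v generic Y l = *-cancelʳ-≤ _ _ N
    (+-cancelʳ-≤ W-u _ _ (subst₂ _≤_ residues-u residues-v
      (generic Y′ (l * N) 2≤lN (λ i → residue≢0 (u i) (weight-u≤total i) (1≤u i))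
                             (λ j → residue≢0 (v j) (weight-v≤total j) (1≤v j)))))
    where
    N = 2 + total-weight
    Y′ : Fin d → ℕ
    Y′ j = Y j * N + 1
    instance
      lN≢0 : NonZero (l * N)
      lN≢0 = m*n≢0 l N
    W-u = sumℕ (λ i → sumℕ (u i))
    2≤lN : 2 ≤ l * N
    2≤lN = *-mono-≤ (ℕ.>-nonZero⁻¹ l) (s≤s (s≤s z≤n))
    residue : ∀ c → sumℕ c ≤ total-weight → evalℕ c Y′ % (l * N) ≡ evalℕ c Y % l * N + sumℕ c
    residue c w≤W = begin
      evalℕ c Y′ % (l * N)                      ≡⟨ cong (_% (l * N)) c[Y′]≡c[Y]N+w ⟩
      (evalℕ c Y * N + sumℕ c) % (l * N)        ≡⟨ [m*n+o]%[p*n]≡[m*n]%[p*n]+o (evalℕ c Y) l (s≤s (m≤n⇒m≤1+n w≤W)) ⟩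
      evalℕ c Y * N % (l * N) + sumℕ c          ≡⟨ cong (_+ sumℕ c) (sym (m%n*o≡m*o%[n*o] (evalℕ c Y) l N)) ⟩
      evalℕ c Y % l * N + sumℕ c                ∎
      where
      open ≡-Reasoning
      c[Y′]≡c[Y]N+w : evalℕ c Y′ ≡ evalℕ c Y * N + sumℕ c
      c[Y′]≡c[Y]N+w = trans (evalℕ-+ c (λ j → Y j * N) (λ _ → 1))
                            (cong₂ _+_ (evalℕ-*ʳ c Y N) (trans (evalℕ-const c 1) (*-identityʳ (sumℕ c))))
    residue≢0 : ∀ c → sumℕ c ≤ total-weight → (∀ j → 1 ≤ c j) → evalℕ c Y′ % (l * N) ≢ 0
    residue≢0 c w≤W 1≤c = subst (_≢ 0) (sym (residue c w≤W)) (n>0⇒n≢0 (≤-trans (1≤sumℕ c 1≤d 1≤c) (m≤n+m _ _)))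
    residues-u : sumℕ (λ i → evalℕ (u i) Y′ % (l * N)) ≡ sumℕ (λ i → evalℕ (u i) Y % l) * N + W-u
    residues-u = trans (sumℕ-cong (λ i → residue (u i) (weight-u≤total i)))
                       (trans (sumℕ-+ (λ i → evalℕ (u i) Y % l * N) (λ i → sumℕ (u i)))
                              (cong (_+ W-u) (sumℕ-*ʳ (λ i → evalℕ (u i) Y % l) N)))
    residues-v : sumℕ (λ j → evalℕ (v j) Y′ % (l * N)) ≡ sumℕ (λ j → evalℕ (v j) Y % l) * N + W-u
    residues-v = trans (sumℕ-cong (λ j → residue (v j) (weight-v≤total j)))
                       (trans (sumℕ-+ (λ j → evalℕ (v j) Y % l * N) (λ j → sumℕ (v j)))
                              (cong₂ _+_ (sumℕ-*ʳ (λ j → evalℕ (v j) Y % l) N) (sym sumℕ-weights-balanced)))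

  module Singularity (n : ℕ) (X : Fin d → ℤ) where

    l : ℕ
    l = suc n

    X̄ : Fin d → ℕ
    X̄ j = X j %ℕ l

    U : Fin k → ℕ
    U i = evalℕ (u i) X̄

    V : Fin m → ℕ
    V j = evalℕ (v j) X̄

    ρu : Fin k → ℕ
    ρu i = (l ∸ U i % l) % l

    ρ : Fin (k + m) → ℕ
    ρ j = [ ρu , (λ j → V j % l) ]′ (splitAt k j)

    P : Fin (k + m) → ℚ
    P = pointP k m u v l X

    P≡ρ/l : ∀ j → P j ≡ + ρ j ℚ./ l
    P≡ρ/l j with splitAt k j
    ... | inj₁ i = trans (frac-/ (ℤ.- evalℤ (u i) X) n)
                         (cong (λ r → + r ℚ./ l) (trans (%ℕ-cong (≡-modℤ-neg (evalℤ-≡-modℤ (u i) X l))) (neg-%ℕ (U i))))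
    ... | inj₂ j = trans (frac-/ (evalℤ (v j) X) n) (cong (λ r → + r ℚ./ l) (%ℕ-cong (evalℤ-≡-modℤ (v j) X l)))

    frac[tP]≡ : ∀ t j → frac ((+ t ℚ./ 1) ℚ.* P j) ≡ + (t * ρ j % l) ℚ./ l
    frac[tP]≡ t j = trans (cong (λ x → frac ((+ t ℚ./ 1) ℚ.* x)) (P≡ρ/l j))
                          (trans (cong frac (*-/ t (ρ j) n)) (frac-/ (+ (t * ρ j)) n))

    frac[tP]≢0⇔ : ∀ t j → frac ((+ t ℚ./ 1) ℚ.* P j) ≢ 0ℚ ⇔ t * ρ j % l ≢ 0
    frac[tP]≢0⇔ t j = mk⇔ (λ frac≢0 tρ≡0 → frac≢0 (trans (frac[tP]≡ t j) (trans (cong (λ r → + r ℚ./ l) tρ≡0) (ℚ.0/n≡0 l))))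
                          (λ tρ≢0 frac≡0 → tρ≢0 (/≡0⇒≡0 _ n (trans (sym (frac[tP]≡ t j)) frac≡0)))

    multipleSum : ℕ → ℕ
    multipleSum t = sumℕ (λ j → t * ρ j % l)

    sumℚ-frac[tP] : ∀ t → sumℚ (λ j → frac ((+ t ℚ./ 1) ℚ.* P j)) ≡ + multipleSum t ℚ./ l
    sumℚ-frac[tP] t = trans (sumℚ-cong (frac[tP]≡ t)) (sumℚ-/ (λ j → t * ρ j % l) n)

    ρ-↑ˡ : ∀ i → ρ (i ↑ˡ m) ≡ ρu i
    ρ-↑ˡ i = cong [ ρu , (λ j → V j % l) ]′ (Fin.splitAt-↑ˡ k i m)

    ρ-↑ʳ : ∀ j → ρ (k ↑ʳ j) ≡ V j % l
    ρ-↑ʳ j = cong [ ρu , (λ j → V j % l) ]′ (Fin.splitAt-↑ʳ k m j)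

    multipleSum-split : ∀ t → multipleSum t ≡ sumℕ (λ i → t * ρu i % l) + sumℕ (λ j → t * V j % l)
    multipleSum-split t = trans (sumℕ-↑ k (λ j → t * ρ j % l))
      (cong₂ _+_ (sumℕ-cong (λ i → cong (λ r → t * r % l) (ρ-↑ˡ i)))
                 (sumℕ-cong (λ j → trans (cong (λ r → t * r % l) (ρ-↑ʳ j)) (m*[n%o]%o≡m*n%o t (V j) l))))

    -- The u-coordinates of tP are the residues of -tU, so they pair off with those of tU.
    multipleSum-balance : ∀ t → (∀ i → t * ρu i % l ≢ 0) →
      multipleSum t + sumℕ (λ i → t * U i % l) ≡ k * l + sumℕ (λ j → t * V j % l)
    multipleSum-balance t tρu≢0 = begin
      multipleSum t + ΣtU                               ≡⟨ cong (_+ ΣtU) (multipleSum-split t) ⟩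
      Σtρu + ΣtV + ΣtU                                  ≡⟨ swap Σtρu ΣtV ΣtU ⟩
      (Σtρu + ΣtU) + ΣtV                                ≡⟨ cong (_+ ΣtV) (sym (sumℕ-+ (λ i → t * ρu i % l) (λ i → t * U i % l))) ⟩
      sumℕ (λ i → t * ρu i % l + t * U i % l) + ΣtV     ≡⟨ cong (_+ ΣtV) (trans (sumℕ-cong pair) (sumℕ-const k l)) ⟩
      k * l + ΣtV                                       ∎
      where
      open ≡-Reasoning
      Σtρu = sumℕ (λ i → t * ρu i % l)
      ΣtU = sumℕ (λ i → t * U i % l)
      ΣtV = sumℕ (λ j → t * V j % l)
      swap : ∀ a b c → a + b + c ≡ (a + c) + b
      swap = solve-∀
      pair : ∀ i → t * ρu i % l + t * U i % l ≡ l
      pair i = complementary-residues (t * ρu i) (t * U i) l (begin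
        (t * ρu i + t * U i) % l   ≡⟨ cong (_% l) (sym (*-distribˡ-+ t (ρu i) (U i))) ⟩
        t * (ρu i + U i) % l       ≡⟨ %-distribˡ-* t (ρu i + U i) l ⟩
        t % l * ((ρu i + U i) % l) % l ≡⟨ cong (λ y → t % l * y % l) ([l∸x%l]%l+x≡0 (U i) l) ⟩
        t % l * 0 % l              ≡⟨ cong (_% l) (*-zeroʳ (t % l)) ⟩
        0 % l                      ≡⟨ 0%n≡0 l ⟩
        0                          ∎) (tρu≢0 i)

    gorenstein : IsGorenstein P
    gorenstein = begin
      frac (sumℚ P)                 ≡⟨ cong frac (trans (sumℚ-cong P≡ρ/l) (sumℚ-/ ρ n)) ⟩
      frac (+ sumℕ ρ ℚ./ l)         ≡⟨ frac-/ (+ sumℕ ρ) n ⟩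
      + (sumℕ ρ % l) ℚ./ l          ≡⟨ cong (λ r → + r ℚ./ l) Σρ%l≡0 ⟩
      + 0 ℚ./ l                     ≡⟨ ℚ.0/n≡0 l ⟩
      0ℚ                            ∎
      where
      open ≡-Reasoning
      Σρu = sumℕ ρu
      Σρ%l≡0 : sumℕ ρ % l ≡ 0
      Σρ%l≡0 = begin
        sumℕ ρ % l                             ≡⟨ cong (_% l) (trans (sumℕ-↑ k ρ) (cong₂ _+_ (sumℕ-cong ρ-↑ˡ) (sumℕ-cong ρ-↑ʳ))) ⟩
        (Σρu + sumℕ (λ j → V j % l)) % l       ≡⟨ %-distribˡ-+ Σρu _ l ⟩
        (Σρu % l + sumℕ (λ j → V j % l) % l) % l ≡⟨ cong (λ y → (Σρu % l + y) % l) (sym (sumℕ-% V l)) ⟩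
        (Σρu % l + sumℕ V % l) % l             ≡⟨ cong (λ y → (Σρu % l + y % l) % l) (sym (sumℕ-evalℕ-balanced X̄)) ⟩
        (Σρu % l + sumℕ U % l) % l             ≡⟨ sym (%-distribˡ-+ Σρu (sumℕ U) l) ⟩
        (Σρu + sumℕ U) % l                     ≡⟨ cong (_% l) (sym (sumℕ-+ ρu U)) ⟩
        sumℕ (λ i → ρu i + U i) % l            ≡⟨ sumℕ-%-cong l (λ i → trans ([l∸x%l]%l+x≡0 (U i) l) (sym (0%n≡0 l))) ⟩
        sumℕ {k} (λ _ → 0) % l                 ≡⟨ cong (_% l) (sumℕ-zero k) ⟩
        0 % l                                  ≡⟨ 0%n≡0 l ⟩
        0                                      ∎

  -- The bound holds for every t, and without the non-vanishing hypotheses on the coordinates of P.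
  landau⇒cond2 : LandauCriterion → Cond2 d k m u v
  landau⇒cond2 landau (suc n) X _ _ = gorenstein , mld
    where
    open Singularity n X
    mld : MldAtLeast P l k
    mld t _ _ frac[tP]≢0 = subst ((+ k ℚ./ 1) ℚ.≤_) (sym (sumℚ-frac[tP] t)) (Equivalence.from (≤-/⇔ k _ n) kl≤Σ)
      where
      tρu≢0 : ∀ i → t * ρu i % l ≢ 0
      tρu≢0 i = subst (λ r → t * r % l ≢ 0) (ρ-↑ˡ i) (Equivalence.to (frac[tP]≢0⇔ t (i ↑ˡ m)) (frac[tP]≢0 (i ↑ˡ m)))
      residueIneq : sumℕ (λ i → t * U i % l) ≤ sumℕ (λ j → t * V j % l)
      residueIneq = subst₂ _≤_ (sumℕ-cong (λ i → cong (_% l) (evalℕ-*ˡ (u i) t X̄)))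
                               (sumℕ-cong (λ j → cong (_% l) (evalℕ-*ˡ (v j) t X̄)))
                               (landau (λ j → t * X̄ j) l)
      kl≤Σ : k * l ≤ multipleSum t
      kl≤Σ = +-cancelʳ-≤ (sumℕ (λ j → t * V j % l)) _ _ (begin
        k * l + sumℕ (λ j → t * V j % l)        ≡⟨ sym (multipleSum-balance t tρu≢0) ⟩
        multipleSum t + sumℕ (λ i → t * U i % l) ≤⟨ +-monoʳ-≤ (multipleSum t) residueIneq ⟩
        multipleSum t + sumℕ (λ j → t * V j % l) ∎)
        where open ≤-Reasoning

  cond2⇒genericLandau : Cond2 d k m u v → GenericLandauCriterion
  cond2⇒genericLandau cond2 Y (suc n) 2≤l u[Y]%l≢0 v[Y]%l≢0 =
    residueIneq-%-cong l (λ j → m%n%n≡m%n (Y j) l)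
      (subst₂ _≤_ (sumℕ-cong 1*U%l≡U%l) (sumℕ-cong 1*V%l≡V%l) residueIneq)
    where
    open Singularity n (λ j → + Y j)
    U%l≡u[Y]%l : ∀ i → U i % l ≡ evalℕ (u i) Y % l
    U%l≡u[Y]%l i = evalℕ-%-cong (u i) l (λ j → m%n%n≡m%n (Y j) l)
    1*U%l≡U%l : ∀ i → 1 * U i % l ≡ U i % l
    1*U%l≡U%l i = cong (_% l) (*-identityˡ (U i))
    1*V%l≡V%l : ∀ j → 1 * V j % l ≡ V j % l
    1*V%l≡V%l j = cong (_% l) (*-identityˡ (V j))
    frac[c/l]≢0 : ∀ c → evalℕ c Y % l ≢ 0 → frac (evalℤ c (λ j → + Y j) ℚ./ l) ≢ 0ℚ
    frac[c/l]≢0 c c[Y]%l≢0 frac≡0 = c[Y]%l≢0 (/≡0⇒≡0 _ n (trans (sym (frac-/ (+ evalℕ c Y) n))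
                                        (trans (cong (λ x → frac (x ℚ./ l)) (sym (evalℤ-+ c Y))) frac≡0)))
    1*ρu%l≢0 : ∀ i → 1 * ρu i % l ≢ 0
    1*ρu%l≢0 i = subst (_≢ 0) (sym (trans (cong (_% l) (*-identityˡ (ρu i))) (m%n%n≡m%n (l ∸ U i % l) l)))
                       ([l∸x%l]%l≢0 (U i) l (subst (_≢ 0) (sym (U%l≡u[Y]%l i)) (u[Y]%l≢0 i)))
    1*V%l%l≢0 : ∀ j → 1 * (V j % l) % l ≢ 0
    1*V%l%l≢0 j = subst (_≢ 0) (sym (trans (cong (_% l) (*-identityˡ (V j % l))) (trans (m%n%n≡m%n (V j) l)
                                   (evalℕ-%-cong (v j) l (λ j → m%n%n≡m%n (Y j) l)))))
                        (v[Y]%l≢0 j)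
    1*ρ%l≢0 : ∀ z → 1 * [ ρu , (λ j → V j % l) ]′ z % l ≢ 0
    1*ρ%l≢0 (inj₁ i) = 1*ρu%l≢0 i
    1*ρ%l≢0 (inj₂ j) = 1*V%l%l≢0 j
    mld : k * l ≤ multipleSum 1
    mld = Equivalence.to (≤-/⇔ k _ n) (subst ((+ k ℚ./ 1) ℚ.≤_) (sumℚ-frac[tP] 1)
            (proj₂ (cond2 l (λ j → + Y j) (λ i → frac[c/l]≢0 (u i) (u[Y]%l≢0 i)) (λ j → frac[c/l]≢0 (v j) (v[Y]%l≢0 j)))
                   1 ≤-refl 2≤l (λ j → Equivalence.from (frac[tP]≢0⇔ 1 j) (1*ρ%l≢0 (splitAt k j)))))
    residueIneq : sumℕ (λ i → 1 * U i % l) ≤ sumℕ (λ j → 1 * V j % l)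
    residueIneq = +-cancelˡ-≤ (multipleSum 1) _ _ (begin
      multipleSum 1 + sumℕ (λ i → 1 * U i % l) ≡⟨ multipleSum-balance 1 1*ρu%l≢0 ⟩
      k * l + sumℕ (λ j → 1 * V j % l)          ≤⟨ +-monoˡ-≤ _ mld ⟩
      multipleSum 1 + sumℕ (λ j → 1 * V j % l)  ∎)
      where open ≤-Reasoning

theorem11 : (d k m : ℕ) → 1 ≤ d →
    (u : Fin k → LinForm d) → (v : Fin m → LinForm d) →
    (∀ i j → 1 ≤ u i j) → (∀ i j → 1 ≤ v i j) →
    (∀ j → sumℕ (λ i → u i j) ≡ sumℕ (λ i → v i j)) →
    Cond1 d k m u v ⇔ Cond2 d k m u v
theorem11 d k m 1≤d u v 1≤u 1≤v balanced = mk⇔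
  (λ cond1 → landau⇒cond2 (cond1⇒landau cond1))
  (λ cond2 → landau⇒cond1 (genericLandau⇒landau 1≤d 1≤u 1≤v (cond2⇒genericLandau cond2)))
  where
  open Balanced u v balanced
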